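{- For every natural number $e\ge1$ there exists a natural number $n$ with $S(n)=2^e$.
   Context: For a natural number $n$ and $a_1,\dots,a_n\in\{0,1\}$, put $A_k=\sum_{i=1}^{n-k}a_ia_{i+k}$ for $0\le k\le n-1$; the sequence is very odd if every $A_k$ ($0\le k\le n-1$) is odd. $S(n)$ is the number of very odd sequences of length $n$. -}

module Defs where

open import Data.Nat using (ℕ; zero; suc; _+_; _*_; _∸_; _<_)
open import Data.Nat.Properties using (_<?_)
open import Data.Fin using (Fin; toℕ)
open import Data.List using (List; []; _∷_; map; _++_; length; filter; upTo)
open import Data.Nat.ListAction using (sum)
open import Data.Vec using (Vec; []; _∷_; lookup)
open import Data.Product using (_×_)
open import Relation.Nullary using (Dec; yes; no)
open import Relation.Unary using (Decidable)

-- A binary sequence a_1 … a_n, stored 0-indexed: a_i (1 ≤ i ≤ n) is (lookup a (i-1)),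
-- each entry in {0,1} ⊆ ℕ.
Seq : ℕ → Set
Seq n = Vec ℕ n

allSeqs : (n : ℕ) → List (Seq n)
allSeqs zero = [] ∷ []
allSeqs (suc n) = map (0 ∷_) (allSeqs n) ++ map (1 ∷_) (allSeqs n)

-- a_j for 0-indexed j (0 outside range, never used inside range sums)
entry : ∀ {n} → Seq n → ℕ → ℕ
entry [] j = 0
entry (x ∷ a) zero = x
entry (x ∷ a) (suc j) = entry a j

-- A_k = Σ_{i=1}^{n-k} a_i a_{i+k}  (0-indexed: Σ_{j=0}^{n-k-1} a_j a_{j+k})
A : ∀ {n} → Seq n → ℕ → ℕ
A {n} a k = sum (map (λ j → entry a j * entry a (j + k)) (upTo (n ∸ k)))

data Odd : ℕ → Set where
  odd-one : Odd 1
  odd-ss  : ∀ {m} → Odd m → Odd (suc (suc m))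

odd? : (m : ℕ) → Dec (Odd m)
odd? zero = no (λ ())
odd? (suc zero) = yes odd-one
odd? (suc (suc m)) with odd? m
... | yes p = yes (odd-ss p)
... | no ¬p = no (λ { (odd-ss p) → ¬p p })

VeryOdd : ∀ {n} → Seq n → Set
VeryOdd {n} a = ∀ k → k < n → Odd (A a k)

veryOdd? : ∀ {n} → Decidable (VeryOdd {n})
veryOdd? {n} a = go n
  where
  open import Data.Nat.Properties using (≤-refl)
  go-aux : (m : ℕ) → Dec (∀ k → k < m → Odd (A a k))
  go-aux zero = yes (λ k ())
  go-aux (suc m) with go-aux m | odd? (A a m)
  ... | no ¬p | _ = no (λ h → ¬p (λ k k<m → h k (Data.Nat.Properties.m<n⇒m<1+n k<m)))
  ... | yes p | no ¬q = no (λ h → ¬q (h m ≤-refl))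
  ... | yes p | yes q = yes λ k k<1+m → aux k (Data.Nat.Properties.m<1+n⇒m<n∨m≡n k<1+m)
    where
    open import Data.Sum using (inj₁; inj₂)
    open import Relation.Binary.PropositionalEquality using (refl)
    aux : ∀ k → _ → Odd (A a k)
    aux k (inj₁ k<m) = p k k<m
    aux k (inj₂ refl) = q
  go : (m : ℕ) → Dec (∀ k → k < m → Odd (A a k))
  go = go-aux

S : ℕ → ℕ
S n = length (filter veryOdd? (allSeqs n))

module Submission where

-- Identify a 0/1 sequence a₀ … a_h with f = Σ aᵢ xⁱ ∈ 𝔽₂[x]. The sum A_k is the coefficient
-- of x^(h+k) (and of x^(h−k)) in f · x^h f(1/x), so a is very odd iff f · x^h f(1/x) is
-- 1 + x + ⋯ + x^(2h). Take 2h + 1 = N = 7^e; then this product is (x^N + 1)/(x + 1), and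
-- x^N + 1 = (x + 1) ∏_{j<e} g(x^(7^j)) gᴿ(x^(7^j)) with g = 1 + x + x³, gᴿ = 1 + x² + x³.
-- Every divisor of x^N + 1 is a subproduct of these 2e + 1 factors: a divisor d is determined
-- by the idempotent d^(2^T − 1) modulo x^N + 1 (2^T ≡ 1 mod N), whose cyclic coefficients
-- are constant on the 2e + 1 orbits of r ↦ 2r on ℤ/N, because 2 and −1 generate the units
-- modulo 7^j. Since f has degree exactly h, it takes exactly one of g(x^(7^j)), gᴿ(x^(7^j))
-- at every level, and each of these 2^e choices works because gᴿ is the reciprocal of g.

open import Data.Nat using (ℕ; suc; _+_; _^_; _≥_)
open import Data.Product using (∃; _,_)
open import Relation.Binary.PropositionalEquality using (_≡_)
open import Defs using (S)

module Polynomial where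

  open import Algebra.Bundles using (CommutativeSemigroup)
  open import Data.Bool using (Bool; true; false; _xor_; _∧_)
  open import Data.Bool.Properties
    using (xor-assoc; xor-comm; xor-same; xor-identityʳ; ∧-comm; ∧-idem)
  open import Data.List using (List; []; _∷_)
  open import Data.Nat using (ℕ; zero; suc; _+_; _*_)
  open import Data.Product using (_×_; _,_)
  open import Relation.Binary.Bundles using (Setoid)
  open import Relation.Binary.PropositionalEquality
  import Algebra.Properties.CommutativeSemigroup as CommSemigroupProperties

  -- Polynomials over 𝔽₂ as coefficient lists, constant term first. Trailing
  -- zeros are allowed, so polynomials are compared coefficientwise.
  Poly : Set
  Poly = List Bool

  coeff : Poly → ℕ → Bool
  coeff []      _       = false
  coeff (a ∷ f) zero    = a
  coeff (a ∷ f) (suc i) = coeff f i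

  infix 4 _≈_
  record _≈_ (f g : Poly) : Set where
    constructor mk≈
    field at : ∀ i → coeff f i ≡ coeff g i
  open _≈_ public

  ≈-refl : ∀ {f} → f ≈ f
  ≈-refl = mk≈ λ _ → refl

  ≈-sym : ∀ {f g} → f ≈ g → g ≈ f
  ≈-sym p = mk≈ λ i → sym (at p i)

  ≈-trans : ∀ {f g h} → f ≈ g → g ≈ h → f ≈ h
  ≈-trans p q = mk≈ λ i → trans (at p i) (at q i)

  ≈-reflexive : ∀ {f g} → f ≡ g → f ≈ g
  ≈-reflexive refl = ≈-refl

  ≈-setoid : Setoid _ _
  ≈-setoid = record
    { Carrier = Poly ; _≈_ = _≈_
    ; isEquivalence = record { refl = ≈-refl ; sym = ≈-sym ; trans = ≈-trans } }

  ∷-cong : ∀ {a b f g} → a ≡ b → f ≈ g → a ∷ f ≈ b ∷ g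
  ∷-cong p q = mk≈ λ { zero → p ; (suc i) → at q i }

  ∷-injective : ∀ {a b f g} → a ∷ f ≈ b ∷ g → a ≡ b × f ≈ g
  ∷-injective p = at p zero , mk≈ λ i → at p (suc i)

  0∷-zero : ∀ {f} → f ≈ [] → false ∷ f ≈ []
  0∷-zero p = mk≈ λ { zero → refl ; (suc i) → at p i }

  ∷-zero⁻ : ∀ {a f} → a ∷ f ≈ [] → a ≡ false × f ≈ []
  ∷-zero⁻ p = at p zero , mk≈ λ i → at p (suc i)

  infixl 6 _⊕_
  _⊕_ : Poly → Poly → Poly
  []      ⊕ g       = g
  (a ∷ f) ⊕ []      = a ∷ f
  (a ∷ f) ⊕ (b ∷ g) = (a xor b) ∷ (f ⊕ g)

  coeff-⊕ : ∀ f g i → coeff (f ⊕ g) i ≡ coeff f i xor coeff g i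
  coeff-⊕ []      g       i       = refl
  coeff-⊕ (a ∷ f) []      i       = sym (xor-identityʳ (coeff (a ∷ f) i))
  coeff-⊕ (a ∷ f) (b ∷ g) zero    = refl
  coeff-⊕ (a ∷ f) (b ∷ g) (suc i) = coeff-⊕ f g i

  scale : Bool → Poly → Poly
  scale false f = []
  scale true  f = f

  coeff-scale : ∀ a f i → coeff (scale a f) i ≡ a ∧ coeff f i
  coeff-scale false f i = refl
  coeff-scale true  f i = refl

  infixl 7 _⊗_
  _⊗_ : Poly → Poly → Poly
  []      ⊗ g = []
  (a ∷ f) ⊗ g = scale a g ⊕ (false ∷ f ⊗ g)

  𝟙 : Poly
  𝟙 = true ∷ []

  ⊕-cong : ∀ {f f′ g g′} → f ≈ f′ → g ≈ g′ → f ⊕ g ≈ f′ ⊕ g′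
  ⊕-cong {f} {f′} {g} {g′} p q = mk≈ λ i → begin
    coeff (f ⊕ g) i            ≡⟨ coeff-⊕ f g i ⟩
    coeff f i xor coeff g i    ≡⟨ cong₂ _xor_ (at p i) (at q i) ⟩
    coeff f′ i xor coeff g′ i  ≡⟨ coeff-⊕ f′ g′ i ⟨
    coeff (f′ ⊕ g′) i          ∎
    where open ≡-Reasoning

  ⊕-comm : ∀ f g → f ⊕ g ≈ g ⊕ f
  ⊕-comm f g = mk≈ λ i →
    trans (coeff-⊕ f g i) (trans (xor-comm (coeff f i) (coeff g i)) (sym (coeff-⊕ g f i)))

  ⊕-assoc : ∀ f g h → f ⊕ g ⊕ h ≈ f ⊕ (g ⊕ h)
  ⊕-assoc f g h = mk≈ λ i → begin
    coeff (f ⊕ g ⊕ h) i                         ≡⟨ coeff-⊕ (f ⊕ g) h i ⟩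
    coeff (f ⊕ g) i xor coeff h i               ≡⟨ cong (_xor coeff h i) (coeff-⊕ f g i) ⟩
    (coeff f i xor coeff g i) xor coeff h i     ≡⟨ xor-assoc (coeff f i) (coeff g i) (coeff h i) ⟩
    coeff f i xor (coeff g i xor coeff h i)     ≡⟨ cong (coeff f i xor_) (coeff-⊕ g h i) ⟨
    coeff f i xor coeff (g ⊕ h) i               ≡⟨ coeff-⊕ f (g ⊕ h) i ⟨
    coeff (f ⊕ (g ⊕ h)) i                       ∎
    where open ≡-Reasoning

  ⊕-identityʳ : ∀ f → f ⊕ [] ≈ f
  ⊕-identityʳ f = mk≈ λ i → trans (coeff-⊕ f [] i) (xor-identityʳ (coeff f i))

  ⊕-self : ∀ f → f ⊕ f ≈ []
  ⊕-self f = mk≈ λ i → trans (coeff-⊕ f f i) (xor-same (coeff f i))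

  ⊕-commutativeSemigroup : CommutativeSemigroup _ _
  ⊕-commutativeSemigroup = record
    { Carrier = Poly ; _≈_ = _≈_ ; _∙_ = _⊕_
    ; isCommutativeSemigroup = record
      { isSemigroup = record
        { isMagma = record { isEquivalence = Setoid.isEquivalence ≈-setoid ; ∙-cong = ⊕-cong }
        ; assoc = ⊕-assoc }
      ; comm = ⊕-comm } }

  open CommSemigroupProperties ⊕-commutativeSemigroup public
    using () renaming (interchange to ⊕-interchange)

  ⊕-cancel : ∀ f g → f ⊕ g ⊕ g ≈ f
  ⊕-cancel f g = ≈-trans (⊕-assoc f g g) (≈-trans (⊕-cong (≈-refl {f}) (⊕-self g)) (⊕-identityʳ f))

  ⊕≈0⇒≈ : ∀ {f g} → f ⊕ g ≈ [] → f ≈ g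
  ⊕≈0⇒≈ {f} {g} p = ≈-trans (≈-sym (⊕-cancel f g)) (⊕-cong p (≈-refl {g}))

  ≈⇒⊕≈0 : ∀ {f g} → f ≈ g → f ⊕ g ≈ []
  ≈⇒⊕≈0 {f} p = ≈-trans (⊕-cong (≈-refl {f}) (≈-sym p)) (⊕-self f)

  scale-cong : ∀ a {f g} → f ≈ g → scale a f ≈ scale a g
  scale-cong false p = ≈-refl
  scale-cong true  p = p

  scale-xor : ∀ a b f → scale (a xor b) f ≈ scale a f ⊕ scale b f
  scale-xor false b     f = ≈-refl
  scale-xor true  false f = ≈-sym (⊕-identityʳ f)
  scale-xor true  true  f = ≈-sym (⊕-self f)

  scale-⊕ : ∀ a f g → scale a (f ⊕ g) ≈ scale a f ⊕ scale a g
  scale-⊕ false f g = ≈-refl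
  scale-⊕ true  f g = ≈-refl

  scale-∷ : ∀ a b f → scale a (b ∷ f) ≈ (a ∧ b) ∷ scale a f
  scale-∷ false b f = ≈-sym (0∷-zero ≈-refl)
  scale-∷ true  b f = ≈-refl

  scale-⊗ : ∀ a f g → scale a f ⊗ g ≈ scale a (f ⊗ g)
  scale-⊗ false f g = ≈-refl
  scale-⊗ true  f g = ≈-refl

  ⊗-zeroˡ : ∀ {f} g → f ≈ [] → f ⊗ g ≈ []
  ⊗-zeroˡ {[]}    g p = ≈-refl
  ⊗-zeroˡ {a ∷ f} g p with ∷-zero⁻ p
  ... | refl , q = 0∷-zero (⊗-zeroˡ g q)

  ⊗-zeroʳ : ∀ f → f ⊗ [] ≈ []
  ⊗-zeroʳ []          = ≈-refl
  ⊗-zeroʳ (false ∷ f) = 0∷-zero (⊗-zeroʳ f)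
  ⊗-zeroʳ (true  ∷ f) = 0∷-zero (⊗-zeroʳ f)

  ⊗-constˡ : ∀ {a f} g → f ≈ [] → (a ∷ f) ⊗ g ≈ scale a g
  ⊗-constˡ {a} g f≈0 = ≈-trans (⊕-cong (≈-refl {scale a g}) (0∷-zero (⊗-zeroˡ g f≈0))) (⊕-identityʳ (scale a g))

  ⊗-congˡ : ∀ {f f′} g → f ≈ f′ → f ⊗ g ≈ f′ ⊗ g
  ⊗-congˡ {[]}    {f′}     g p = ≈-sym (⊗-zeroˡ g (≈-sym p))
  ⊗-congˡ {a ∷ f} {[]}     g p = ⊗-zeroˡ g p
  ⊗-congˡ {a ∷ f} {b ∷ f′} g p with ∷-injective p
  ... | refl , q = ⊕-cong (≈-refl {scale a g}) (∷-cong refl (⊗-congˡ g q))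

  ⊗-congʳ : ∀ f {g g′} → g ≈ g′ → f ⊗ g ≈ f ⊗ g′
  ⊗-congʳ []      p = ≈-refl
  ⊗-congʳ (a ∷ f) p = ⊕-cong (scale-cong a p) (∷-cong refl (⊗-congʳ f p))

  ⊗-cong : ∀ {f f′ g g′} → f ≈ f′ → g ≈ g′ → f ⊗ g ≈ f′ ⊗ g′
  ⊗-cong {f′ = f′} {g} p q = ≈-trans (⊗-congˡ g p) (⊗-congʳ f′ q)

  ⊗-distribʳ : ∀ f g h → (f ⊕ g) ⊗ h ≈ f ⊗ h ⊕ g ⊗ h
  ⊗-distribʳ []      g       h = ≈-refl
  ⊗-distribʳ (a ∷ f) []      h = ≈-sym (⊕-identityʳ _)
  ⊗-distribʳ (a ∷ f) (b ∷ g) h =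
    ≈-trans (⊕-cong (scale-xor a b h) (∷-cong refl (⊗-distribʳ f g h)))
            (⊕-interchange (scale a h) (scale b h) (false ∷ f ⊗ h) (false ∷ g ⊗ h))

  ⊗-distribˡ : ∀ f g h → f ⊗ (g ⊕ h) ≈ f ⊗ g ⊕ f ⊗ h
  ⊗-distribˡ []      g h = ≈-refl
  ⊗-distribˡ (a ∷ f) g h =
    ≈-trans (⊕-cong (scale-⊕ a g h) (∷-cong refl (⊗-distribˡ f g h)))
            (⊕-interchange (scale a g) (scale a h) (false ∷ f ⊗ g) (false ∷ f ⊗ h))

  ⊗-∷ʳ : ∀ f b g → f ⊗ (b ∷ g) ≈ scale b f ⊕ (false ∷ f ⊗ g)
  ⊗-∷ʳ []      false g = ≈-sym (0∷-zero ≈-refl)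
  ⊗-∷ʳ []      true  g = ≈-sym (0∷-zero ≈-refl)
  ⊗-∷ʳ (a ∷ f) b     g = begin
    scale a (b ∷ g) ⊕ (false ∷ f ⊗ (b ∷ g))
      ≈⟨ ⊕-cong (scale-∷ a b g) (∷-cong refl (⊗-∷ʳ f b g)) ⟩
    ((a ∧ b) ∷ scale a g) ⊕ (false ∷ (scale b f ⊕ (false ∷ f ⊗ g)))
      ≈⟨ ∷-cong (cong (_xor false) (∧-comm a b)) (swap (scale a g) (scale b f) (false ∷ f ⊗ g)) ⟩
    ((b ∧ a) ∷ scale b f) ⊕ (false ∷ (scale a g ⊕ (false ∷ f ⊗ g)))
      ≈⟨ ⊕-cong (scale-∷ b a f) (≈-refl {false ∷ scale a g ⊕ (false ∷ f ⊗ g)}) ⟨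
    scale b (a ∷ f) ⊕ (false ∷ (a ∷ f) ⊗ g) ∎
    where
    open import Relation.Binary.Reasoning.Setoid ≈-setoid
    swap : ∀ x y z → x ⊕ (y ⊕ z) ≈ y ⊕ (x ⊕ z)
    swap x y z = ≈-trans (≈-sym (⊕-assoc x y z))
                         (≈-trans (⊕-cong (⊕-comm x y) (≈-refl {z})) (⊕-assoc y x z))

  ⊗-comm : ∀ f g → f ⊗ g ≈ g ⊗ f
  ⊗-comm []      g = ≈-sym (⊗-zeroʳ g)
  ⊗-comm (a ∷ f) g =
    ≈-trans (⊕-cong (≈-refl {scale a g}) (∷-cong refl (⊗-comm f g))) (≈-sym (⊗-∷ʳ g a f))

  ⊗-assoc : ∀ f g h → f ⊗ g ⊗ h ≈ f ⊗ (g ⊗ h)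
  ⊗-assoc []      g h = ≈-refl
  ⊗-assoc (a ∷ f) g h =
    ≈-trans (⊗-distribʳ (scale a g) (false ∷ f ⊗ g) h)
            (⊕-cong (scale-⊗ a g h) (∷-cong refl (⊗-assoc f g h)))

  ⊗-identityˡ : ∀ f → 𝟙 ⊗ f ≈ f
  ⊗-identityˡ f = ≈-trans (⊕-cong (≈-refl {f}) (0∷-zero ≈-refl)) (⊕-identityʳ f)

  ⊗-identityʳ : ∀ f → f ⊗ 𝟙 ≈ f
  ⊗-identityʳ f = ≈-trans (⊗-comm f 𝟙) (⊗-identityˡ f)

  ⊗-commutativeSemigroup : CommutativeSemigroup _ _
  ⊗-commutativeSemigroup = record
    { Carrier = Poly ; _≈_ = _≈_ ; _∙_ = _⊗_
    ; isCommutativeSemigroup = record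
      { isSemigroup = record
        { isMagma = record { isEquivalence = Setoid.isEquivalence ≈-setoid ; ∙-cong = ⊗-cong }
        ; assoc = ⊗-assoc }
      ; comm = ⊗-comm } }

  open CommSemigroupProperties ⊗-commutativeSemigroup public
    using () renaming (interchange to ⊗-interchange)

  shift : ℕ → Poly → Poly
  shift zero    f = f
  shift (suc k) f = false ∷ shift k f

  x^_ : ℕ → Poly
  x^ k = shift k 𝟙

  shift-cong : ∀ k {f g} → f ≈ g → shift k f ≈ shift k g
  shift-cong zero    p = p
  shift-cong (suc k) p = ∷-cong refl (shift-cong k p)

  shift-zero : ∀ k {f} → f ≈ [] → shift k f ≈ []
  shift-zero zero    p = p
  shift-zero (suc k) p = 0∷-zero (shift-zero k p)

  shift-⊕ : ∀ k f g → shift k f ⊕ shift k g ≈ shift k (f ⊕ g)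
  shift-⊕ zero    f g = ≈-refl
  shift-⊕ (suc k) f g = ∷-cong refl (shift-⊕ k f g)

  shift-⊗ : ∀ k f g → shift k f ⊗ g ≈ shift k (f ⊗ g)
  shift-⊗ zero    f g = ≈-refl
  shift-⊗ (suc k) f g = ∷-cong refl (shift-⊗ k f g)

  ⊗-shift : ∀ f k g → f ⊗ shift k g ≈ shift k (f ⊗ g)
  ⊗-shift f k g = ≈-trans (⊗-comm f (shift k g)) (≈-trans (shift-⊗ k g f) (shift-cong k (⊗-comm g f)))

  shift-+ : ∀ j k f → shift j (shift k f) ≡ shift (j + k) f
  shift-+ zero    k f = refl
  shift-+ (suc j) k f = cong (false ∷_) (shift-+ j k f)

  shift≈x^⊗ : ∀ k f → shift k f ≈ x^ k ⊗ f
  shift≈x^⊗ k f = ≈-sym (≈-trans (shift-⊗ k 𝟙 f) (shift-cong k (⊗-identityˡ f)))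

  infixr 8 _^ᴾ_
  _^ᴾ_ : Poly → ℕ → Poly
  f ^ᴾ zero  = 𝟙
  f ^ᴾ suc k = f ⊗ f ^ᴾ k

  ^ᴾ-+ : ∀ f j k → f ^ᴾ (j + k) ≈ f ^ᴾ j ⊗ f ^ᴾ k
  ^ᴾ-+ f zero    k = ≈-sym (⊗-identityˡ (f ^ᴾ k))
  ^ᴾ-+ f (suc j) k = ≈-trans (⊗-congʳ f (^ᴾ-+ f j k)) (≈-sym (⊗-assoc f (f ^ᴾ j) (f ^ᴾ k)))

  infix 4 _∣_
  record _∣_ (d f : Poly) : Set where
    constructor divides
    field
      quotient : Poly
      equation : f ≈ d ⊗ quotient

  ∣-respʳ : ∀ {d f f′} → f ≈ f′ → d ∣ f → d ∣ f′
  ∣-respʳ p (divides q e) = divides q (≈-trans (≈-sym p) e)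

  ∣-refl : ∀ {d} → d ∣ d
  ∣-refl {d} = divides 𝟙 (≈-sym (⊗-identityʳ d))

  ∣-zero : ∀ {d} → d ∣ []
  ∣-zero {d} = divides [] (≈-sym (⊗-zeroʳ d))

  ∣-trans : ∀ {a b c} → a ∣ b → b ∣ c → a ∣ c
  ∣-trans {a} (divides q p) (divides r s) =
    divides (q ⊗ r) (≈-trans s (≈-trans (⊗-congˡ r p) (⊗-assoc a q r)))

  d∣d⊗g : ∀ d g → d ∣ d ⊗ g
  d∣d⊗g d g = divides g ≈-refl

  d∣g⊗d : ∀ d g → d ∣ g ⊗ d
  d∣g⊗d d g = divides g (⊗-comm g d)

  ∣-⊗-mono : ∀ {a b c d} → a ∣ b → c ∣ d → a ⊗ c ∣ b ⊗ d
  ∣-⊗-mono {a} {c = c} (divides q p) (divides r s) =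
    divides (q ⊗ r) (≈-trans (⊗-cong p s) (⊗-interchange a q c r))

  ∣⇒∣⊗ : ∀ {d f} g → d ∣ f → d ∣ g ⊗ f
  ∣⇒∣⊗ {f = f} g p = ∣-trans p (d∣g⊗d f g)

  ∣-⊕ : ∀ {d f g} → d ∣ f → d ∣ g → d ∣ f ⊕ g
  ∣-⊕ {d} (divides q p) (divides r s) =
    divides (q ⊕ r) (≈-trans (⊕-cong p s) (≈-sym (⊗-distribˡ d q r)))

  -- inflate m f is f(x^(1+m)).
  inflate : ℕ → Poly → Poly
  inflate m []      = []
  inflate m (a ∷ f) = a ∷ shift m (inflate m f)

  inflate-zero : ∀ m {f} → f ≈ [] → inflate m f ≈ []
  inflate-zero m {[]}    p = ≈-refl
  inflate-zero m {a ∷ f} p with ∷-zero⁻ p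
  ... | refl , q = 0∷-zero (shift-zero m (inflate-zero m q))

  inflate-cong : ∀ m {f g} → f ≈ g → inflate m f ≈ inflate m g
  inflate-cong m {[]}    {g}     p = ≈-sym (inflate-zero m (≈-sym p))
  inflate-cong m {a ∷ f} {[]}    p = inflate-zero m p
  inflate-cong m {a ∷ f} {b ∷ g} p with ∷-injective p
  ... | refl , q = ∷-cong refl (shift-cong m (inflate-cong m q))

  inflate-⊕ : ∀ m f g → inflate m (f ⊕ g) ≈ inflate m f ⊕ inflate m g
  inflate-⊕ m []      g       = ≈-refl
  inflate-⊕ m (a ∷ f) []      = ≈-refl
  inflate-⊕ m (a ∷ f) (b ∷ g) = ∷-cong refl
    (≈-trans (shift-cong m (inflate-⊕ m f g)) (≈-sym (shift-⊕ m (inflate m f) (inflate m g))))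

  inflate-scale : ∀ m a f → inflate m (scale a f) ≈ scale a (inflate m f)
  inflate-scale m false f = ≈-refl
  inflate-scale m true  f = ≈-refl

  inflate-⊗ : ∀ m f g → inflate m (f ⊗ g) ≈ inflate m f ⊗ inflate m g
  inflate-⊗ m []      g = ≈-refl
  inflate-⊗ m (a ∷ f) g = begin
    inflate m (scale a g ⊕ (false ∷ f ⊗ g))
      ≈⟨ inflate-⊕ m (scale a g) (false ∷ f ⊗ g) ⟩
    inflate m (scale a g) ⊕ (false ∷ shift m (inflate m (f ⊗ g)))
      ≈⟨ ⊕-cong (inflate-scale m a g) (∷-cong refl (shift-cong m (inflate-⊗ m f g))) ⟩
    scale a (inflate m g) ⊕ (false ∷ shift m (inflate m f ⊗ inflate m g))
      ≈⟨ ⊕-cong (≈-refl {scale a (inflate m g)}) (∷-cong refl (≈-sym (shift-⊗ m (inflate m f) (inflate m g)))) ⟩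
    scale a (inflate m g) ⊕ (false ∷ shift m (inflate m f) ⊗ inflate m g) ∎
    where open import Relation.Binary.Reasoning.Setoid ≈-setoid

  inflate-𝟙 : ∀ m → inflate m 𝟙 ≈ 𝟙
  inflate-𝟙 m = ∷-cong refl (shift-zero m ≈-refl)

  inflate-shift : ∀ m k f → inflate m (shift k f) ≈ shift (k * suc m) (inflate m f)
  inflate-shift m zero    f = ≈-refl
  inflate-shift m (suc k) f = ≈-trans (∷-cong refl (shift-cong m (inflate-shift m k f)))
    (≈-reflexive (cong (false ∷_) (shift-+ m (k * suc m) (inflate m f))))

  inflate-x^ : ∀ m k → inflate m (x^ k) ≈ x^ (k * suc m)
  inflate-x^ m k = ≈-trans (inflate-shift m k 𝟙) (shift-cong (k * suc m) (inflate-𝟙 m))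

  inflate-∣ : ∀ m {d f} → d ∣ f → inflate m d ∣ inflate m f
  inflate-∣ m {d} (divides q p) = divides (inflate m q) (≈-trans (inflate-cong m p) (inflate-⊗ m d q))

  frobenius : ∀ f → f ⊗ f ≈ inflate 1 f
  frobenius []      = ≈-refl
  frobenius (a ∷ f) = begin
    scale a (a ∷ f) ⊕ (false ∷ f ⊗ (a ∷ f))
      ≈⟨ ⊕-cong (scale-∷ a a f) (∷-cong refl (⊗-∷ʳ f a f)) ⟩
    ((a ∧ a) ∷ scale a f) ⊕ (false ∷ (scale a f ⊕ (false ∷ f ⊗ f)))
      ≈⟨ ∷-cong (trans (xor-identityʳ (a ∧ a)) (∧-idem a)) (≈-sym (⊕-assoc (scale a f) (scale a f) _)) ⟩
    a ∷ (scale a f ⊕ scale a f ⊕ (false ∷ f ⊗ f))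
      ≈⟨ ∷-cong refl (⊕-cong (⊕-self (scale a f)) (≈-refl {false ∷ f ⊗ f})) ⟩
    a ∷ (false ∷ f ⊗ f)
      ≈⟨ ∷-cong refl (∷-cong refl (frobenius f)) ⟩
    a ∷ (false ∷ inflate 1 f) ∎
    where open import Relation.Binary.Reasoning.Setoid ≈-setoid

module Degree where

  open import Data.Bool using (true; false; _xor_)
  open import Data.Empty using (⊥-elim)
  open import Data.List using ([]; _∷_)
  open import Data.Nat using (ℕ; zero; suc; _+_; _*_; _≤_; _<_; z≤n; s≤s; s≤s⁻¹)
  open import Data.Nat.Properties
  open import Data.Product using (_,_; ∃)
  open import Data.Sum using (_⊎_; inj₁; inj₂)
  open import Relation.Binary.Definitions using (tri<; tri≈; tri>)
  open import Relation.Binary.PropositionalEquality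
  open import Relation.Nullary using (¬_; yes; no)
  open Polynomial

  infix 4 deg_<_ deg_≡_

  record deg_<_ (f : Poly) (L : ℕ) : Set where
    constructor mk<
    field vanish : ∀ i → L ≤ i → coeff f i ≡ false
  open deg_<_ public

  record deg_≡_ (f : Poly) (n : ℕ) : Set where
    constructor mk≡
    field
      leading : coeff f n ≡ true
      beyond  : deg f < suc n
  open deg_≡_ public

  deg<-zero : ∀ {f} → deg f < 0 → f ≈ []
  deg<-zero d = mk≈ λ i → vanish d i z≤n

  deg<-[] : ∀ L → deg [] < L
  deg<-[] L = mk< λ _ _ → refl

  deg<-mono : ∀ {f L M} → L ≤ M → deg f < L → deg f < M
  deg<-mono L≤M d = mk< λ i M≤i → vanish d i (≤-trans L≤M M≤i)

  deg<-cong : ∀ {f g L} → f ≈ g → deg f < L → deg g < L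
  deg<-cong p d = mk< λ i L≤i → trans (sym (at p i)) (vanish d i L≤i)

  deg<-tail : ∀ {a f L} → deg (a ∷ f) < suc L → deg f < L
  deg<-tail d = mk< λ i L≤i → vanish d (suc i) (s≤s L≤i)

  deg<-∷ : ∀ {a f L} → deg f < L → deg (a ∷ f) < suc L
  deg<-∷ d = mk< λ { zero () ; (suc i) (s≤s L≤i) → vanish d i L≤i }

  deg<-⊕ : ∀ {f g L} → deg f < L → deg g < L → deg (f ⊕ g) < L
  deg<-⊕ {f} {g} d e = mk< λ i L≤i → trans (coeff-⊕ f g i) (cong₂ _xor_ (vanish d i L≤i) (vanish e i L≤i))

  deg<-scale : ∀ a {f L} → deg f < L → deg (scale a f) < L
  deg<-scale false d = deg<-[] _
  deg<-scale true  d = d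

  deg<-⊗ : ∀ {f g m n} → deg f < suc m → deg g < suc n → deg (f ⊗ g) < suc (m + n)
  deg<-⊗ {[]}    d e = deg<-[] _
  deg<-⊗ {a ∷ f} {g} {zero} d e =
    deg<-cong (≈-sym (⊗-constˡ g (deg<-zero (deg<-tail d)))) (deg<-scale a e)
  deg<-⊗ {a ∷ f} {g} {suc m} {n} d e =
    deg<-⊕ (deg<-mono (s≤s (≤-trans (m≤n+m n m) (n≤1+n _))) (deg<-scale a e)) (deg<-∷ (deg<-⊗ (deg<-tail d) e))

  deg≡⇒≉0 : ∀ {f n} → deg f ≡ n → ¬ (f ≈ [])
  deg≡⇒≉0 {n = n} d p with () ← trans (sym (leading d)) (at p n)

  deg≡-cong : ∀ {f g n} → f ≈ g → deg f ≡ n → deg g ≡ n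
  deg≡-cong {n = n} p d = mk≡ (trans (sym (at p n)) (leading d)) (deg<-cong p (beyond d))

  deg≡-unique : ∀ {f m n} → deg f ≡ m → deg f ≡ n → m ≡ n
  deg≡-unique {m = m} {n} d e with <-cmp m n
  ... | tri< m<n _ _ with () ← trans (sym (leading e)) (vanish (beyond d) n m<n)
  ... | tri≈ _ m≡n _ = m≡n
  ... | tri> _ _ n<m with () ← trans (sym (leading d)) (vanish (beyond e) m n<m)

  deg≡-∷ : ∀ {a f n} → deg f ≡ n → deg (a ∷ f) ≡ suc n
  deg≡-∷ d = mk≡ (leading d) (deg<-∷ (beyond d))

  deg≡-tail : ∀ {a f n} → deg (a ∷ f) ≡ suc n → deg f ≡ n
  deg≡-tail d = mk≡ (leading d) (deg<-tail (beyond d))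

  deg≡-⊕ʳ : ∀ {f g m n} → deg f < suc m → deg g ≡ n → m < n → deg (f ⊕ g) ≡ n
  deg≡-⊕ʳ {f} {g} {n = n} d e m<n = mk≡
    (trans (coeff-⊕ f g n) (cong₂ _xor_ (vanish d n m<n) (leading e)))
    (deg<-⊕ (deg<-mono (≤-trans m<n (n≤1+n _)) d) (beyond e))

  deg≡-⊕ˡ : ∀ {f g m n} → deg f ≡ n → deg g < suc m → m < n → deg (f ⊕ g) ≡ n
  deg≡-⊕ˡ {f} {g} d e m<n = deg≡-cong (⊕-comm g f) (deg≡-⊕ʳ e d m<n)

  deg≡-⊗ : ∀ {f g m n} → deg f ≡ m → deg g ≡ n → deg (f ⊗ g) ≡ m + n
  deg≡-⊗ {[]}    d e = ⊥-elim (deg≡⇒≉0 d ≈-refl)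
  deg≡-⊗ {a ∷ f} {g} {zero} d e with leading d
  ... | refl = deg≡-cong (≈-sym (⊗-constˡ g (deg<-zero (deg<-tail (beyond d))))) e
  deg≡-⊗ {a ∷ f} {g} {suc m} {n} d e =
    deg≡-⊕ʳ (deg<-scale a (beyond e)) (deg≡-∷ (deg≡-⊗ (deg≡-tail d) e)) (s≤s (m≤n+m n m))

  deg≡-𝟙 : deg 𝟙 ≡ 0
  deg≡-𝟙 = mk≡ refl (mk< λ { zero () ; (suc i) _ → refl })

  deg≡-shift : ∀ k {f n} → deg f ≡ n → deg (shift k f) ≡ k + n
  deg≡-shift zero    d = d
  deg≡-shift (suc k) d = deg≡-∷ (deg≡-shift k d)

  deg≡-x^ : ∀ k → deg (x^ k) ≡ k
  deg≡-x^ k = subst (deg (x^ k) ≡_) (+-identityʳ k) (deg≡-shift k deg≡-𝟙)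

  deg≡-inflate : ∀ m {f n} → deg f ≡ n → deg (inflate m f) ≡ suc m * n
  deg≡-inflate m {[]}    d = ⊥-elim (deg≡⇒≉0 d ≈-refl)
  deg≡-inflate m {a ∷ f} {zero} d with leading d
  ... | refl = subst (deg (inflate m (a ∷ f)) ≡_) (sym (*-zeroʳ m)) (mk≡ refl (deg<-∷ (deg<-cong tail≈0 (deg<-[] 0))))
    where
    tail≈0 : [] ≈ shift m (inflate m f)
    tail≈0 = ≈-sym (shift-zero m (inflate-zero m (deg<-zero (deg<-tail (beyond d)))))
  deg≡-inflate m {a ∷ f} {suc n} d =
    subst (deg (inflate m (a ∷ f)) ≡_) (sym (*-suc (suc m) n))
          (deg≡-∷ (deg≡-shift m (deg≡-inflate m (deg≡-tail d))))

  ≈0⊎deg≡ : ∀ f → f ≈ [] ⊎ ∃ λ n → deg f ≡ n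
  ≈0⊎deg≡ []      = inj₁ ≈-refl
  ≈0⊎deg≡ (a ∷ f) with ≈0⊎deg≡ f
  ≈0⊎deg≡ (false ∷ f) | inj₁ p       = inj₁ (0∷-zero p)
  ≈0⊎deg≡ (true  ∷ f) | inj₁ p       = inj₂ (0 , mk≡ refl (deg<-∷ (deg<-cong (≈-sym p) (deg<-[] 0))))
  ≈0⊎deg≡ (a     ∷ f) | inj₂ (n , d) = inj₂ (suc n , deg≡-∷ d)

  ⊗-cancelˡ : ∀ {f g h n} → deg f ≡ n → f ⊗ g ≈ f ⊗ h → g ≈ h
  ⊗-cancelˡ {f} {g} {h} d p with ≈0⊎deg≡ (g ⊕ h)
  ... | inj₁ g⊕h≈0     = ⊕≈0⇒≈ g⊕h≈0
  ... | inj₂ (_ , d′) = ⊥-elim (deg≡⇒≉0 (deg≡-⊗ d d′) (≈-trans (⊗-distribˡ f g h) (≈⇒⊕≈0 p)))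

  deg≡0⇒≈𝟙 : ∀ {f} → deg f ≡ 0 → f ≈ 𝟙
  deg≡0⇒≈𝟙 {[]}    d = ⊥-elim (deg≡⇒≉0 d ≈-refl)
  deg≡0⇒≈𝟙 {a ∷ f} d with leading d
  ... | refl = ∷-cong refl (deg<-zero (deg<-tail (beyond d)))

  ∣⇒deg≤ : ∀ {d f m n} → deg d ≡ m → deg f ≡ n → d ∣ f → m ≤ n
  ∣⇒deg≤ {d} {f} {m} dm fn (divides q p) with ≈0⊎deg≡ q
  ... | inj₁ q≈0       = ⊥-elim (deg≡⇒≉0 fn (≈-trans p (≈-trans (⊗-congʳ d q≈0) (⊗-zeroʳ d))))
  ... | inj₂ (k , qk) = subst (m ≤_) (deg≡-unique (deg≡-⊗ dm qk) (deg≡-cong p fn)) (m≤m+n m k)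

  ∣-antisym : ∀ {d d′ n} → deg d ≡ n → d ∣ d′ → d′ ∣ d → d ≈ d′
  ∣-antisym {d} {d′} dn (divides a p) (divides b q) with ≈0⊎deg≡ a | ≈0⊎deg≡ b
  ... | inj₁ a≈0 | _ =
    ⊥-elim (deg≡⇒≉0 dn (≈-trans q (⊗-zeroˡ b (≈-trans p (≈-trans (⊗-congʳ d a≈0) (⊗-zeroʳ d))))))
  ... | inj₂ _ | inj₁ b≈0 =
    ⊥-elim (deg≡⇒≉0 dn (≈-trans q (≈-trans (⊗-congʳ d′ b≈0) (⊗-zeroʳ d′))))
  ... | inj₂ (i , ai) | inj₂ (j , bj) =
    ≈-sym (≈-trans p (≈-trans (⊗-congʳ d (deg≡0⇒≈𝟙 (subst (deg a ≡_) i≡0 ai))) (⊗-identityʳ d)))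
    where
    ab≈𝟙 : a ⊗ b ≈ 𝟙
    ab≈𝟙 = ⊗-cancelˡ dn (≈-trans (≈-sym (⊗-assoc d a b))
                        (≈-trans (⊗-congˡ b (≈-sym p)) (≈-trans (≈-sym q) (≈-sym (⊗-identityʳ d)))))
    i≡0 : i ≡ 0
    i≡0 = m+n≡0⇒m≡0 i (deg≡-unique (deg≡-⊗ ai bj) (deg≡-cong (≈-sym ab≈𝟙) deg≡-𝟙))

  deg≡⇒< : ∀ {f d L} → deg f ≡ d → deg f < L → d < L
  deg≡⇒< {d = d} {L} deg-f f<L with d <? L
  ... | yes d<L = d<L
  ... | no  d≮L with () ← trans (sym (leading deg-f)) (vanish f<L d (≮⇒≥ d≮L))

  deg≡-maximal-factor : ∀ {f g h} → deg f < suc h → deg g < suc h → deg (f ⊗ g) ≡ h + h → deg f ≡ h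
  deg≡-maximal-factor {f} {g} {h} f≤h g≤h fg≡2h with ≈0⊎deg≡ f | ≈0⊎deg≡ g
  ... | inj₁ f≈0 | _ = ⊥-elim (deg≡⇒≉0 fg≡2h (⊗-zeroˡ g f≈0))
  ... | inj₂ _ | inj₁ g≈0 = ⊥-elim (deg≡⇒≉0 fg≡2h (≈-trans (⊗-congʳ f g≈0) (⊗-zeroʳ f)))
  ... | inj₂ (i , deg-f) | inj₂ (j , deg-g) = subst (deg f ≡_) i≡h deg-f
    where
    i≤h : i ≤ h
    i≤h = s≤s⁻¹ (deg≡⇒< deg-f f≤h)
    j≤h : j ≤ h
    j≤h = s≤s⁻¹ (deg≡⇒< deg-g g≤h)
    i+j≡2h : i + j ≡ h + h
    i+j≡2h = deg≡-unique (deg≡-⊗ deg-f deg-g) fg≡2h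
    i≡h : i ≡ h
    i≡h with <-cmp i h
    ... | tri< i<h _ _ = ⊥-elim (<-irrefl i+j≡2h (+-mono-<-≤ i<h j≤h))
    ... | tri≈ _ i≡h _ = i≡h
    ... | tri> _ _ h<i = ⊥-elim (<⇒≱ h<i i≤h)

module Congruence where

  open import Data.Nat using (ℕ; _+_; _*_; _%_; _/_; NonZero)
  open import Data.Nat.DivMod using (m≡m%n+[m/n]*n; [m+kn]%n≡m%n)
  open import Data.Nat.Properties using (+-cancelʳ-≡; +-identityʳ; *-identityʳ; *-assoc; +-comm)
  open import Data.Nat.Tactic.RingSolver using (solve-∀)
  open import Relation.Binary.Bundles using (Setoid)
  open import Relation.Binary.PropositionalEquality

  -- Congruence on ℕ stated without subtraction, for an arbitrary modulus.
  infix 4 _≡_mod_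
  record _≡_mod_ (a b m : ℕ) : Set where
    constructor mod-by
    field
      k₁ k₂ : ℕ
      equation : a + k₁ * m ≡ b + k₂ * m
  open _≡_mod_ public

  mod-refl : ∀ {a m} → a ≡ a mod m
  mod-refl = mod-by 0 0 refl

  mod-reflexive : ∀ {a b m} → a ≡ b → a ≡ b mod m
  mod-reflexive refl = mod-refl

  mod-sym : ∀ {a b m} → a ≡ b mod m → b ≡ a mod m
  mod-sym (mod-by x y e) = mod-by y x (sym e)

  mod-trans : ∀ {a b c m} → a ≡ b mod m → b ≡ c mod m → a ≡ c mod m
  mod-trans {a} {b} {c} {m} (mod-by x y e) (mod-by x′ y′ e′) =
    mod-by (x + x′) (y + y′) (+-cancelʳ-≡ (y * m) _ _ (begin
      a + (x + x′) * m + y * m          ≡⟨ l₁ a x x′ m y ⟩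
      a + x * m + (x′ * m + y * m)      ≡⟨ cong (_+ (x′ * m + y * m)) e ⟩
      b + y * m + (x′ * m + y * m)      ≡⟨ l₂ b y m x′ ⟩
      b + x′ * m + (y * m + y * m)      ≡⟨ cong (_+ (y * m + y * m)) e′ ⟩
      c + y′ * m + (y * m + y * m)      ≡⟨ l₃ c y′ m y ⟩
      c + (y + y′) * m + y * m          ∎))
    where
    open ≡-Reasoning
    l₁ : ∀ a x x′ m y → a + (x + x′) * m + y * m ≡ a + x * m + (x′ * m + y * m)
    l₁ = solve-∀
    l₂ : ∀ b y m x′ → b + y * m + (x′ * m + y * m) ≡ b + x′ * m + (y * m + y * m)
    l₂ = solve-∀
    l₃ : ∀ c y′ m y → c + y′ * m + (y * m + y * m) ≡ c + (y + y′) * m + y * m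
    l₃ = solve-∀

  mod-setoid : ℕ → Setoid _ _
  mod-setoid m = record
    { Carrier = ℕ ; _≈_ = λ a b → a ≡ b mod m
    ; isEquivalence = record { refl = mod-refl ; sym = mod-sym ; trans = mod-trans } }

  mod-+ : ∀ {a b c d m} → a ≡ b mod m → c ≡ d mod m → a + c ≡ b + d mod m
  mod-+ {a} {b} {c} {d} {m} (mod-by x y e) (mod-by x′ y′ e′) = mod-by (x + x′) (y + y′) (begin
    a + c + (x + x′) * m        ≡⟨ l a c x x′ m ⟩
    (a + x * m) + (c + x′ * m)  ≡⟨ cong₂ _+_ e e′ ⟩
    (b + y * m) + (d + y′ * m)  ≡⟨ l b d y y′ m ⟨
    b + d + (y + y′) * m        ∎)
    where
    open ≡-Reasoning
    l : ∀ a c x x′ m → a + c + (x + x′) * m ≡ (a + x * m) + (c + x′ * m)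
    l = solve-∀

  mod-* : ∀ {a b c d m} → a ≡ b mod m → c ≡ d mod m → a * c ≡ b * d mod m
  mod-* {a} {b} {c} {d} {m} (mod-by x y e) (mod-by x′ y′ e′) =
    mod-by (a * x′ + x * c + x * x′ * m) (b * y′ + y * d + y * y′ * m) (begin
      a * c + (a * x′ + x * c + x * x′ * m) * m  ≡⟨ l a c x x′ m ⟩
      (a + x * m) * (c + x′ * m)                 ≡⟨ cong₂ _*_ e e′ ⟩
      (b + y * m) * (d + y′ * m)                 ≡⟨ l b d y y′ m ⟨
      b * d + (b * y′ + y * d + y * y′ * m) * m  ∎)
    where
    open ≡-Reasoning
    l : ∀ a c x x′ m → a * c + (a * x′ + x * c + x * x′ * m) * m ≡ (a + x * m) * (c + x′ * m)
    l = solve-∀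

  mod-cancel-+ʳ : ∀ {a b} c {m} → a + c ≡ b + c mod m → a ≡ b mod m
  mod-cancel-+ʳ {a} {b} c {m} (mod-by x y e) = mod-by x y (+-cancelʳ-≡ c _ _ (begin
    a + x * m + c  ≡⟨ l a x m c ⟩
    a + c + x * m  ≡⟨ e ⟩
    b + c + y * m  ≡⟨ l b y m c ⟨
    b + y * m + c  ∎))
    where
    open ≡-Reasoning
    l : ∀ a x m c → a + x * m + c ≡ a + c + x * m
    l = solve-∀

  mod-scaleˡ : ∀ {a b m} c → a ≡ b mod m → c * a ≡ c * b mod c * m
  mod-scaleˡ {a} {b} {m} c (mod-by x y e) = mod-by x y (begin
    c * a + x * (c * m)  ≡⟨ l c a x m ⟩
    c * (a + x * m)      ≡⟨ cong (c *_) e ⟩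
    c * (b + y * m)      ≡⟨ l c b y m ⟨
    c * b + y * (c * m)  ∎)
    where
    open ≡-Reasoning
    l : ∀ c a x m → c * a + x * (c * m) ≡ c * (a + x * m)
    l = solve-∀

  mod-scaleʳ : ∀ {a b m} c → a ≡ b mod m → a * c ≡ b * c mod m * c
  mod-scaleʳ {a} {b} {m} c (mod-by x y e) = mod-by x y (begin
    a * c + x * (m * c)  ≡⟨ l c a x m ⟩
    (a + x * m) * c      ≡⟨ cong (_* c) e ⟩
    (b + y * m) * c      ≡⟨ l c b y m ⟨
    b * c + y * (m * c)  ∎)
    where
    open ≡-Reasoning
    l : ∀ c a x m → a * c + x * (m * c) ≡ (a + x * m) * c
    l = solve-∀

  mod-divisor : ∀ {a b m} q → a ≡ b mod q * m → a ≡ b mod m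
  mod-divisor {a} {b} {m} q (mod-by x y e) =
    mod-by (x * q) (y * q) (trans (cong (a +_) (*-assoc x q m)) (trans e (cong (b +_) (sym (*-assoc y q m)))))

  mod-+-multiple : ∀ {m} a k → a + k * m ≡ a mod m
  mod-+-multiple a k = mod-by 0 k (+-identityʳ _)

  mod-1 : ∀ a b → a ≡ b mod 1
  mod-1 a b = mod-by b a (trans (cong (a +_) (*-identityʳ b)) (trans (+-comm a b) (cong (b +_) (sym (*-identityʳ a)))))

  mod⇒% : ∀ {a b m} .{{_ : NonZero m}} → a ≡ b mod m → a % m ≡ b % m
  mod⇒% {a} {b} {m} (mod-by x y e) = trans (sym ([m+kn]%n≡m%n a x m)) (trans (cong (_% m) e) ([m+kn]%n≡m%n b y m))

  %⇒mod : ∀ {a b m} .{{_ : NonZero m}} → a % m ≡ b % m → a ≡ b mod m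
  %⇒mod {a} {b} {m} e = mod-by (b / m) (a / m) (begin
    a + b / m * m                      ≡⟨ cong (_+ b / m * m) (m≡m%n+[m/n]*n a m) ⟩
    a % m + a / m * m + b / m * m      ≡⟨ cong (λ r → r + a / m * m + b / m * m) e ⟩
    b % m + a / m * m + b / m * m      ≡⟨ l (b % m) (a / m * m) (b / m * m) ⟩
    b % m + b / m * m + a / m * m      ≡⟨ cong (_+ a / m * m) (m≡m%n+[m/n]*n b m) ⟨
    b + a / m * m                      ∎)
    where
    open ≡-Reasoning
    l : ∀ p q r → p + q + r ≡ p + r + q
    l = solve-∀

open Congruence using (_≡_mod_)

module PowersOfTwo where

  open import Data.Fin using (Fin; zero; suc)
  open import Data.Empty using (⊥-elim)
  open import Data.Nat using (ℕ; zero; suc; _+_; _*_; _^_; _∸_; _%_; _/_; _<_; s≤s)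
  open import Data.Nat.DivMod using (m≡m%n+[m/n]*n; m%n<n)
  open import Data.Nat.Properties
  open import Data.Nat.Tactic.RingSolver using (solve-∀)
  open import Data.Product using (∃; ∃₂; _,_; proj₁; proj₂)
  open import Data.Sum using (_⊎_; inj₁; inj₂)
  open import Data.Vec using (Vec; []; _∷_; lookup; map)
  open import Data.Vec.Properties using (lookup-map)
  open import Relation.Binary.PropositionalEquality
  open import Relation.Nullary using (yes; no)
  open Congruence

  8^7^j : ∀ j → ∃ λ w → 8 ^ 7 ^ j ≡ 1 + 7 ^ suc j * (1 + 7 * w)
  8^7^j zero    = 0 , refl
  8^7^j (suc j) with w , eq ← 8^7^j j = w + X * R * c , (begin
    8 ^ (7 * 7 ^ j)              ≡⟨ cong (8 ^_) (*-comm 7 (7 ^ j)) ⟩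
    8 ^ (7 ^ j * 7)              ≡⟨ ^-*-assoc 8 (7 ^ j) 7 ⟨
    (8 ^ 7 ^ j) ^ 7              ≡⟨ cong (_^ 7) (trans eq (cong (1 +_) (*-assoc 7 (7 ^ j) c))) ⟩
    (1 + 7 * X) ^ 7              ≡⟨ seventh-power X ⟩
    1 + 49 * X * (1 + 7 * (X * R))  ≡⟨ regroup (7 ^ j) w R ⟩
    1 + 7 ^ suc (suc j) * (1 + 7 * (w + X * R * c)) ∎)
    where
    open ≡-Reasoning
    c X R : ℕ
    c = 1 + 7 * w
    X = 7 ^ j * c
    R = 3 + 35 * X + 245 * (X * X) + 1029 * (X * X * X) + 2401 * (X * X * X * X) + 2401 * (X * X * X * X * X)
    -- The ring solver does not handle _^_, so (1 + 7X)^7 is spelled out as the product it unfolds to.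
    seventh-power : ∀ X → (1 + 7 * X) * ((1 + 7 * X) * ((1 + 7 * X) * ((1 + 7 * X) * ((1 + 7 * X)
                          * ((1 + 7 * X) * ((1 + 7 * X) * 1)))))) ≡
      1 + 49 * X * (1 + 7 * (X * (3 + 35 * X + 245 * (X * X) + 1029 * (X * X * X)
                                   + 2401 * (X * X * X * X) + 2401 * (X * X * X * X * X))))
    seventh-power = solve-∀
    regroup : ∀ B w R → 1 + 49 * (B * (1 + 7 * w)) * (1 + 7 * (B * (1 + 7 * w) * R))
                      ≡ 1 + 7 * (7 * B) * (1 + 7 * (w + B * (1 + 7 * w) * R * (1 + 7 * w)))
    regroup = solve-∀

  2^[3·7^e]≡1 : ∀ e → 2 ^ (3 * 7 ^ e) ≡ 1 mod 7 ^ e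
  2^[3·7^e]≡1 e with w , eq ← 8^7^j e =
    mod-trans (mod-reflexive (trans (sym (^-*-assoc 2 3 (7 ^ e))) (trans eq (cong (1 +_) (regroup (7 ^ e) w)))))
              (mod-+-multiple 1 (7 * (1 + 7 * w)))
    where
    regroup : ∀ B w → 7 * B * (1 + 7 * w) ≡ 7 * (1 + 7 * w) * B
    regroup = solve-∀

  2^-invertible-mod-7 : ∀ k → ∃ λ b → 2 ^ k * b ≡ 1 mod 7
  2^-invertible-mod-7 zero = 1 , mod-refl
  2^-invertible-mod-7 (suc k) with b , inv ← 2^-invertible-mod-7 k =
    4 * b , mod-trans (mod-reflexive (regroup (2 ^ k) b)) (mod-* {8} {1} (mod-by 0 1 refl) inv)
    where
    regroup : ∀ p b → 2 * p * (4 * b) ≡ 8 * (p * b)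
    regroup = solve-∀

  binomial-mod-square : ∀ A t → (1 + A) ^ t ≡ 1 + t * A mod A * A
  binomial-mod-square A zero    = mod-refl
  binomial-mod-square A (suc t) = begin
    (1 + A) * (1 + A) ^ t          ≈⟨ mod-* (mod-refl {1 + A}) (binomial-mod-square A t) ⟩
    (1 + A) * (1 + t * A)          ≡⟨ expand A t ⟩
    1 + suc t * A + t * (A * A)    ≈⟨ mod-+-multiple (1 + suc t * A) t ⟩
    1 + suc t * A                  ∎
    where
    open import Relation.Binary.Reasoning.Setoid (mod-setoid (A * A))
    expand : ∀ A t → (1 + A) * (1 + t * A) ≡ 1 + suc t * A + t * (A * A)
    expand = solve-∀

  solve-linear-mod-7 : ∀ k {W} x y → W ≡ 1 mod 7 → ∃ λ t → y + t * (2 ^ k * W) ≡ x mod 7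
  solve-linear-mod-7 k {W} x y W≡1 with b , inv ← 2^-invertible-mod-7 k = (x + 6 * y) * b , (begin
    y + (x + 6 * y) * b * (2 ^ k * W)    ≡⟨ cong (y +_) (regroup x y b (2 ^ k) W) ⟩
    y + (x + 6 * y) * (2 ^ k * b * W)    ≈⟨ mod-+ (mod-refl {y}) (mod-* (mod-refl {x + 6 * y}) (mod-* inv W≡1)) ⟩
    y + (x + 6 * y) * (1 * 1)            ≡⟨ collect x y ⟩
    x + y * 7                            ≈⟨ mod-+-multiple x y ⟩
    x                                    ∎)
    where
    open import Relation.Binary.Reasoning.Setoid (mod-setoid 7)
    regroup : ∀ x y b p W → (x + 6 * y) * b * (p * W) ≡ (x + 6 * y) * (p * b * W)
    regroup = solve-∀
    collect : ∀ x y → y + (x + 6 * y) * (1 * 1) ≡ x + y * 7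
    collect = solve-∀

  -- Hensel-type lifting: 2^(3·7^j) ≡ 1 + 7^(j+1) (mod 7^(j+2)), so multiplying 2^k by a
  -- suitable power of it corrects a congruence mod 7^(j+1) to one mod 7^(j+2).
  -- Kept abstract: unfolding the exponent it constructs makes later type checking blow up.
  abstract
    lift : ∀ j {k z v} → 2 ^ k + z ≡ v mod 7 ^ suc j → ∃ λ k′ → 2 ^ k′ + z ≡ v mod 7 ^ suc (suc j)
    lift j {k} {z} {v} (mod-by x y hyp) = k + 3 * B * t , mod-cancel-+ʳ (x * M) (begin
      2 ^ (k + 3 * B * t) + z + x * M          ≡⟨ cong (λ p → p + z + x * M) power ⟩
      2 ^ k * (1 + M * W) ^ t + z + x * M      ≈⟨ mod-+ (mod-+ binomial (mod-refl {z})) (mod-refl {x * M}) ⟩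
      2 ^ k * (1 + t * (M * W)) + z + x * M    ≡⟨ rearrange (2 ^ k) t M W z x ⟩
      (2 ^ k + z + x * M) + t * a * M          ≡⟨ cong (_+ t * a * M) hyp ⟩
      v + y * M + t * a * M                    ≡⟨ +-assoc v (y * M) (t * a * M) ⟩
      v + (y * M + t * a * M)                  ≡⟨ cong (v +_) (sym (*-distribʳ-+ M y (t * a))) ⟩
      v + (y + t * a) * M                      ≈⟨ mod-+ (mod-refl {v}) (mod-scaleʳ M digit) ⟩
      v + x * M                                ∎)
      where
      open import Relation.Binary.Reasoning.Setoid (mod-setoid (7 ^ suc (suc j)))
      B M w W a t : ℕ
      B = 7 ^ j
      M = 7 * B
      w = proj₁ (8^7^j j)
      W = 1 + 7 * w
      a = 2 ^ k * W
      W≡1 : W ≡ 1 mod 7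
      W≡1 = mod-trans (mod-reflexive (cong suc (*-comm 7 w))) (mod-+-multiple 1 w)
      t = proj₁ (solve-linear-mod-7 k x y W≡1)
      digit : y + t * a ≡ x mod 7
      digit = proj₂ (solve-linear-mod-7 k x y W≡1)
      power : 2 ^ (k + 3 * B * t) ≡ 2 ^ k * (1 + M * W) ^ t
      power = trans (^-distribˡ-+-* 2 k (3 * B * t)) (cong (2 ^ k *_)
                (trans (sym (^-*-assoc 2 (3 * B) t)) (cong (_^ t) (trans (sym (^-*-assoc 2 3 B)) (proj₂ (8^7^j j))))))
      binomial : 2 ^ k * (1 + M * W) ^ t ≡ 2 ^ k * (1 + t * (M * W)) mod 7 ^ suc (suc j)
      binomial = mod-* (mod-refl {2 ^ k}) (mod-divisor (B * W * W)
        (subst (λ m → (1 + M * W) ^ t ≡ 1 + t * (M * W) mod m) (square B W) (binomial-mod-square (M * W) t)))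
        where
        square : ∀ B W → 7 * B * W * (7 * B * W) ≡ B * W * W * (7 * (7 * B))
        square = solve-∀
      rearrange : ∀ p t M W z x → p * (1 + t * (M * W)) + z + x * M ≡ (p + z + x * M) + t * (p * W) * M
      rearrange = solve-∀

  ±PowerOfTwo : ℕ → ℕ → Set
  ±PowerOfTwo M u = ∃ λ k → 2 ^ k ≡ u mod M ⊎ 2 ^ k + u ≡ 0 mod M

  ±PowerOfTwo-resp : ∀ {M u v} → u ≡ v mod M → ±PowerOfTwo M u → ±PowerOfTwo M v
  ±PowerOfTwo-resp u≡v (k , inj₁ p) = k , inj₁ (mod-trans p u≡v)
  ±PowerOfTwo-resp u≡v (k , inj₂ p) = k , inj₂ (mod-trans (mod-+ (mod-refl {2 ^ k}) (mod-sym u≡v)) p)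

  ±PowerOfTwo-mod-7 : ∀ u → u % 7 ≢ 0 → ±PowerOfTwo 7 u
  ±PowerOfTwo-mod-7 u u≢0 =
    ±PowerOfTwo-resp (mod-sym (mod-trans (mod-reflexive (m≡m%n+[m/n]*n u 7)) (mod-+-multiple (u % 7) (u / 7))))
                     (residue (u % 7) (m%n<n u 7) u≢0)
    where
    residue : ∀ r → r < 7 → r ≢ 0 → ±PowerOfTwo 7 r
    residue 0 _ r≢0 = ⊥-elim (r≢0 refl)
    residue 1 _ _ = 0 , inj₁ mod-refl
    residue 2 _ _ = 1 , inj₁ mod-refl
    residue 3 _ _ = 2 , inj₂ (mod-by 0 1 refl)
    residue 4 _ _ = 2 , inj₁ mod-refl
    residue 5 _ _ = 1 , inj₂ (mod-by 0 1 refl)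
    residue 6 _ _ = 0 , inj₂ (mod-by 0 1 refl)
    residue (suc (suc (suc (suc (suc (suc (suc _))))))) (s≤s (s≤s (s≤s (s≤s (s≤s (s≤s (s≤s ()))))))) _

  ±PowerOfTwo-mod-7^ : ∀ j u → u % 7 ≢ 0 → ±PowerOfTwo (7 ^ suc j) u
  ±PowerOfTwo-mod-7^ zero    u u≢0 = ±PowerOfTwo-mod-7 u u≢0
  ±PowerOfTwo-mod-7^ (suc j) u u≢0 with ±PowerOfTwo-mod-7^ j u u≢0
  ... | k , inj₁ 2^k≡u with k′ , p ← lift j {k} {0} (mod-trans (mod-reflexive (+-identityʳ (2 ^ k))) 2^k≡u) =
    k′ , inj₁ (mod-trans (mod-reflexive (sym (+-identityʳ (2 ^ k′)))) p)
  ... | k , inj₂ 2^k+u≡0 with k′ , p ← lift j {k} {u} {0} 2^k+u≡0 = k′ , inj₂ p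

  cosetCount : ℕ → ℕ
  cosetCount zero    = 1
  cosetCount (suc e) = 2 + cosetCount e

  -- Representatives of the orbits of multiplication by 2 on ℤ/7^e: 1 and -1 for the
  -- units, then 7 times the representatives for 7^(e-1).
  cosetReps : (e : ℕ) → Vec ℕ (cosetCount e)
  cosetReps zero    = 0 ∷ []
  cosetReps (suc e) = 1 ∷ (7 ^ suc e ∸ 1) ∷ map (7 *_) (cosetReps e)

  coset-decomposition : ∀ e i → ∃₂ λ k (c : Fin (cosetCount e)) → 2 ^ k * lookup (cosetReps e) c ≡ i mod 7 ^ e
  coset-decomposition zero    i = 0 , zero , mod-1 _ _
  coset-decomposition (suc e) i with i % 7 ≟ 0
  ... | no i≢0 with ±PowerOfTwo-mod-7^ e i i≢0
  ...   | k , inj₁ 2^k≡i   = k , zero , mod-trans (mod-reflexive (*-identityʳ (2 ^ k))) 2^k≡i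
  ...   | k , inj₂ 2^k+i≡0 = k , suc zero , (begin
    2 ^ k * (M ∸ 1)                      ≡⟨ +-identityʳ _ ⟨
    2 ^ k * (M ∸ 1) + 0                  ≈⟨ mod-+ (mod-refl {2 ^ k * (M ∸ 1)}) 2^k+i≡0 ⟨
    2 ^ k * (M ∸ 1) + (2 ^ k + i)        ≡⟨ regroup (2 ^ k) (M ∸ 1) i ⟩
    i + 2 ^ k * (1 + (M ∸ 1))            ≡⟨ cong (λ m → i + 2 ^ k * m) (m+[n∸m]≡n (m^n>0 7 (suc e))) ⟩
    i + 2 ^ k * M                        ≈⟨ mod-+-multiple i (2 ^ k) ⟩
    i                                    ∎)
    where
    open import Relation.Binary.Reasoning.Setoid (mod-setoid (7 ^ suc e))
    M : ℕ
    M = 7 ^ suc e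
    regroup : ∀ p x i → p * x + (p + i) ≡ i + p * (1 + x)
    regroup = solve-∀
  coset-decomposition (suc e) i | yes 7∣i with k , c , p ← coset-decomposition e (i / 7) =
    k , suc (suc c) , mod-trans (mod-reflexive shuffle) (mod-trans (mod-scaleˡ 7 p) (mod-reflexive i≡7[i/7]))
    where
    shuffle : 2 ^ k * lookup (map (7 *_) (cosetReps e)) c ≡ 7 * (2 ^ k * lookup (cosetReps e) c)
    shuffle = trans (cong (2 ^ k *_) (lookup-map c (7 *_) (cosetReps e))) (*-comm-left (2 ^ k) 7 _)
      where
      *-comm-left : ∀ a b c → a * (b * c) ≡ b * (a * c)
      *-comm-left = solve-∀
    i≡7[i/7] : 7 * (i / 7) ≡ i
    i≡7[i/7] = sym (trans (m≡m%n+[m/n]*n i 7) (trans (cong (_+ i / 7 * 7) 7∣i) (*-comm (i / 7) 7)))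

  ⌊7^_/2⌋ : ℕ → ℕ
  ⌊7^ zero  /2⌋ = 0
  ⌊7^ suc e /2⌋ = 7 * ⌊7^ e /2⌋ + 3

  7^≡2⌊7^/2⌋+1 : ∀ e → 7 ^ e ≡ suc (⌊7^ e /2⌋ + ⌊7^ e /2⌋)
  7^≡2⌊7^/2⌋+1 zero    = refl
  7^≡2⌊7^/2⌋+1 (suc e) = trans (cong (7 *_) (7^≡2⌊7^/2⌋+1 e)) (regroup ⌊7^ e /2⌋)
    where
    regroup : ∀ h → 7 * suc (h + h) ≡ suc (7 * h + 3 + (7 * h + 3))
    regroup = solve-∀

module CyclicCoefficients (h : ℕ) where

  open import Data.Nat using (ℕ; zero; suc; _+_; _*_; _∸_; _%_; _≤_; _<_; z≤n; s≤s)
  open import Algebra.Bundles using (CommutativeRing; CommutativeMonoid)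
  import Algebra.Properties.CommutativeSemigroup as CommSemigroupProperties
  open import Data.Bool using (Bool; true; false; _xor_; _∧_)
  open import Data.Bool.Properties
    using (xor-same; xor-identityʳ; ∧-zeroʳ; ∧-identityʳ; ∧-distribʳ-xor; xor-∧-commutativeRing)
  open import Data.Empty using (⊥-elim)
  open import Data.List using ([]; _∷_)
  open import Data.Nat.DivMod using (m<n⇒m%n≡m)
  open import Data.Nat.Properties
  open import Data.Nat.Tactic.RingSolver using (solve-∀)
  open import Data.Product using (∃; _×_; _,_)
  open import Function using (_∘_; case_of_)
  open import Relation.Binary.Definitions using (tri<; tri≈; tri>)
  open import Relation.Binary.PropositionalEquality
  open import Relation.Nullary using (Dec; does; yes; no)
  open import Relation.Nullary.Decidable using (map′; does-⇔; dec-true; dec-false)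
  open import Function.Bundles using (mk⇔)
  open Congruence
  open Polynomial
  open Degree

  open CommSemigroupProperties
    (CommutativeMonoid.commutativeSemigroup (CommutativeRing.+-commutativeMonoid xor-∧-commutativeRing))
    using () renaming (interchange to xor-interchange)

  N : ℕ
  N = suc (h + h)

  _≡?_mod-N : ∀ p r → Dec (p ≡ r mod N)
  p ≡? r mod-N = map′ %⇒mod mod⇒% (p % N ≟ r % N)

  same-residue : ℕ → ℕ → Bool
  same-residue p r = does (p ≡? r mod-N)

  same-residue-cong : ∀ p r p′ r′ → (p ≡ r mod N → p′ ≡ r′ mod N) →
                      (p′ ≡ r′ mod N → p ≡ r mod N) → same-residue p r ≡ same-residue p′ r′
  same-residue-cong p r p′ r′ to from = does-⇔ (mk⇔ to from) (p ≡? r mod-N) (p′ ≡? r′ mod-N)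

  mod-N-below : ∀ {p r} → p < N → r < N → p ≡ r mod N → p ≡ r
  mod-N-below p<N r<N p≡r = trans (sym (m<n⇒m%n≡m p<N)) (trans (mod⇒% p≡r) (m<n⇒m%n≡m r<N))

  -- N is odd, so halving is possible modulo N.
  mod-N-halve : ∀ {p r} → p + p ≡ r + r mod N → p ≡ r mod N
  mod-N-halve {p} {r} 2p≡2r =
    mod-trans (mod-sym (mod-+-multiple p p))
      (mod-trans (mod-reflexive (halving p h))
        (mod-trans (mod-* (mod-refl {suc h}) 2p≡2r)
          (mod-trans (mod-reflexive (sym (halving r h))) (mod-+-multiple r r))))
    where
    halving : ∀ x h → x + x * suc (h + h) ≡ suc h * (x + x)
    halving = solve-∀

  -- cyclicFrom p u r is the coefficient of x^r in x^p u reduced modulo x^N + 1.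
  cyclicFrom : ℕ → Poly → ℕ → Bool
  cyclicFrom p []      r = false
  cyclicFrom p (a ∷ u) r = (a ∧ same-residue p r) xor cyclicFrom (suc p) u r

  cyclic : Poly → ℕ → Bool
  cyclic = cyclicFrom 0

  cyclicFrom-⊕ : ∀ p u v r → cyclicFrom p (u ⊕ v) r ≡ cyclicFrom p u r xor cyclicFrom p v r
  cyclicFrom-⊕ p []      v       r = refl
  cyclicFrom-⊕ p (a ∷ u) []      r = sym (xor-identityʳ _)
  cyclicFrom-⊕ p (a ∷ u) (b ∷ v) r =
    trans (cong₂ _xor_ (∧-distribʳ-xor (same-residue p r) a b) (cyclicFrom-⊕ (suc p) u v r))
          (xor-interchange (a ∧ same-residue p r) (b ∧ same-residue p r) _ _)

  cyclicFrom-zero : ∀ {u} p r → u ≈ [] → cyclicFrom p u r ≡ false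
  cyclicFrom-zero {[]}    p r u≈0 = refl
  cyclicFrom-zero {a ∷ u} p r u≈0 with ∷-zero⁻ u≈0
  ... | refl , u≈0′ = cyclicFrom-zero (suc p) r u≈0′

  cyclicFrom-cong : ∀ {u v} p r → u ≈ v → cyclicFrom p u r ≡ cyclicFrom p v r
  cyclicFrom-cong {[]}    {v}     p r u≈v = sym (cyclicFrom-zero p r (≈-sym u≈v))
  cyclicFrom-cong {a ∷ u} {[]}    p r u≈v = cyclicFrom-zero p r u≈v
  cyclicFrom-cong {a ∷ u} {b ∷ v} p r u≈v with ∷-injective u≈v
  ... | refl , u≈v′ = cong (a ∧ same-residue p r xor_) (cyclicFrom-cong (suc p) r u≈v′)

  cyclicFrom-shift : ∀ k u p r → cyclicFrom p (shift k u) r ≡ cyclicFrom (k + p) u r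
  cyclicFrom-shift zero    u p r = refl
  cyclicFrom-shift (suc k) u p r = trans (cyclicFrom-shift k u (suc p) r) (cong (λ q → cyclicFrom q u r) (+-suc k p))

  cyclicFrom-respˡ : ∀ u {p p′} r → p ≡ p′ mod N → cyclicFrom p u r ≡ cyclicFrom p′ u r
  cyclicFrom-respˡ []      r p≡p′ = refl
  cyclicFrom-respˡ (a ∷ u) {p} {p′} r p≡p′ = cong₂ _xor_
    (cong (a ∧_) (same-residue-cong p r p′ r (mod-trans (mod-sym p≡p′)) (mod-trans p≡p′)))
    (cyclicFrom-respˡ u r (mod-+ (mod-refl {1}) p≡p′))

  cyclicFrom-respʳ : ∀ u p {r r′} → r ≡ r′ mod N → cyclicFrom p u r ≡ cyclicFrom p u r′
  cyclicFrom-respʳ []      p r≡r′ = refl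
  cyclicFrom-respʳ (a ∷ u) p {r} {r′} r≡r′ = cong₂ _xor_
    (cong (a ∧_) (same-residue-cong p r p r′ (λ q → mod-trans q r≡r′) (λ q → mod-trans q (mod-sym r≡r′))))
    (cyclicFrom-respʳ u (suc p) r≡r′)

  cyclicFrom-inflate : ∀ u p r → cyclicFrom (p + p) (inflate 1 u) (r + r) ≡ cyclicFrom p u r
  cyclicFrom-inflate []      p r = refl
  cyclicFrom-inflate (a ∷ u) p r = cong₂ _xor_
    (cong (a ∧_) (same-residue-cong (p + p) (r + r) p r mod-N-halve (λ p≡r → mod-+ p≡r p≡r)))
    (trans (cong (λ q → cyclicFrom q (inflate 1 u) (r + r)) (sym (+-suc (suc p) p)))
           (cyclicFrom-inflate u (suc p) r))

  cyclic-square : ∀ u r → cyclic (u ⊗ u) (r + r) ≡ cyclic u r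
  cyclic-square u r = trans (cyclicFrom-cong 0 (r + r) (frobenius u)) (cyclicFrom-inflate u 0 r)

  xᴺ+1 : Poly
  xᴺ+1 = x^ N ⊕ 𝟙

  deg-xᴺ+1 : deg xᴺ+1 ≡ N
  deg-xᴺ+1 = deg≡-⊕ˡ (deg≡-x^ N) (beyond deg≡-𝟙) (s≤s z≤n)

  cyclic-multiple : ∀ {w} r → xᴺ+1 ∣ w → cyclic w r ≡ false
  cyclic-multiple {w} r (divides q w≈) = begin
    cyclic w r                                  ≡⟨ cyclicFrom-cong 0 r (≈-trans w≈ xᴺ+1⊗q) ⟩
    cyclic (shift N q ⊕ q) r                    ≡⟨ cyclicFrom-⊕ 0 (shift N q) q r ⟩
    cyclicFrom 0 (shift N q) r xor cyclic q r   ≡⟨ cong (_xor cyclic q r) (cyclicFrom-shift N q 0 r) ⟩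
    cyclicFrom (N + 0) q r xor cyclic q r       ≡⟨ cong (_xor cyclic q r) (cyclicFrom-respˡ q r N+0≡0) ⟩
    cyclic q r xor cyclic q r                   ≡⟨ xor-same (cyclic q r) ⟩
    false                                       ∎
    where
    open ≡-Reasoning
    xᴺ+1⊗q : xᴺ+1 ⊗ q ≈ shift N q ⊕ q
    xᴺ+1⊗q = ≈-trans (⊗-distribʳ (x^ N) 𝟙 q) (⊕-cong (≈-sym (shift≈x^⊗ N q)) (⊗-identityˡ q))
    N+0≡0 : N + 0 ≡ 0 mod N
    N+0≡0 = mod-by 0 1 (+-identityʳ (N + 0))

  infix 4 _≡_mod-xᴺ+1
  record _≡_mod-xᴺ+1 (u v : Poly) : Set where
    constructor by-multiple
    field multiple : xᴺ+1 ∣ u ⊕ v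
  open _≡_mod-xᴺ+1 public

  ≈⇒≡-mod-xᴺ+1 : ∀ {u v} → u ≈ v → u ≡ v mod-xᴺ+1
  ≈⇒≡-mod-xᴺ+1 u≈v = by-multiple (∣-respʳ (≈-sym (≈⇒⊕≈0 u≈v)) ∣-zero)

  mod-xᴺ+1-sym : ∀ {u v} → u ≡ v mod-xᴺ+1 → v ≡ u mod-xᴺ+1
  mod-xᴺ+1-sym {u} {v} (by-multiple p) = by-multiple (∣-respʳ (⊕-comm u v) p)

  mod-xᴺ+1-trans : ∀ {u v w} → u ≡ v mod-xᴺ+1 → v ≡ w mod-xᴺ+1 → u ≡ w mod-xᴺ+1
  mod-xᴺ+1-trans {u} {v} {w} (by-multiple p) (by-multiple q) = by-multiple (∣-respʳ telescope (∣-⊕ p q))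
    where
    telescope : u ⊕ v ⊕ (v ⊕ w) ≈ u ⊕ w
    telescope = ≈-trans (≈-sym (⊕-assoc (u ⊕ v) v w)) (⊕-cong (⊕-cancel u v) (≈-refl {w}))

  mod-xᴺ+1-⊗ˡ : ∀ {u v} c → u ≡ v mod-xᴺ+1 → c ⊗ u ≡ c ⊗ v mod-xᴺ+1
  mod-xᴺ+1-⊗ˡ {u} {v} c (by-multiple p) = by-multiple (∣-respʳ (⊗-distribˡ c u v) (∣⇒∣⊗ c p))

  mod-xᴺ+1-⊗ʳ : ∀ {u v} c → u ≡ v mod-xᴺ+1 → u ⊗ c ≡ v ⊗ c mod-xᴺ+1
  mod-xᴺ+1-⊗ʳ {u} {v} c (by-multiple p) =
    by-multiple (∣-respʳ (≈-trans (⊗-comm c (u ⊕ v)) (⊗-distribʳ u v c)) (∣⇒∣⊗ c p))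

  cyclic-cong : ∀ {u v} r → u ≡ v mod-xᴺ+1 → cyclic u r ≡ cyclic v r
  cyclic-cong {u} {v} r (by-multiple p) = xor≡false⇒≡ (trans (sym (cyclicFrom-⊕ 0 u v r)) (cyclic-multiple r p))
    where
    xor≡false⇒≡ : ∀ {x y} → x xor y ≡ false → x ≡ y
    xor≡false⇒≡ {false} {false} _ = refl
    xor≡false⇒≡ {true}  {true}  _ = refl

  reduce-top : ∀ {u} → deg u < suc N → ∃ λ v → deg v < N × u ≡ v mod-xᴺ+1
  reduce-top {u} u<N+1 = u ⊕ scale (coeff u N) xᴺ+1 , mk< vanishing , u≡v
    where
    b : Bool
    b = coeff u N
    vanishing : ∀ i → N ≤ i → coeff (u ⊕ scale b xᴺ+1) i ≡ false
    vanishing i N≤i with <-cmp N i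
    ... | tri≈ _ refl _ = begin
      coeff (u ⊕ scale b xᴺ+1) N    ≡⟨ coeff-⊕ u (scale b xᴺ+1) N ⟩
      b xor coeff (scale b xᴺ+1) N  ≡⟨ cong (b xor_) (coeff-scale b xᴺ+1 N) ⟩
      b xor (b ∧ coeff xᴺ+1 N)      ≡⟨ cong (λ c → b xor (b ∧ c)) (leading deg-xᴺ+1) ⟩
      b xor (b ∧ true)              ≡⟨ cong (b xor_) (∧-identityʳ b) ⟩
      b xor b                       ≡⟨ xor-same b ⟩
      false                         ∎
      where open ≡-Reasoning
    ... | tri< N<i _ _ = begin
      coeff (u ⊕ scale b xᴺ+1) i                    ≡⟨ coeff-⊕ u (scale b xᴺ+1) i ⟩
      coeff u i xor coeff (scale b xᴺ+1) i          ≡⟨ cong₂ _xor_ (vanish u<N+1 i N<i) (coeff-scale b xᴺ+1 i) ⟩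
      false xor (b ∧ coeff xᴺ+1 i)                  ≡⟨ cong (λ c → b ∧ c) (vanish (beyond deg-xᴺ+1) i N<i) ⟩
      b ∧ false                                     ≡⟨ ∧-zeroʳ b ⟩
      false                                         ∎
      where open ≡-Reasoning
    ... | tri> _ _ i<N = ⊥-elim (<⇒≱ i<N N≤i)
    u≡v : u ≡ u ⊕ scale b xᴺ+1 mod-xᴺ+1
    u≡v = by-multiple (∣-respʳ (≈-sym (≈-trans (≈-sym (⊕-assoc u u (scale b xᴺ+1)))
                                               (⊕-cong (⊕-self u) (≈-refl {scale b xᴺ+1}))))
                               (scale-multiple b))
      where
      scale-multiple : ∀ b → xᴺ+1 ∣ scale b xᴺ+1
      scale-multiple false = ∣-zero
      scale-multiple true  = ∣-refl

  reduce : ∀ w → ∃ λ v → deg v < N × w ≡ v mod-xᴺ+1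
  reduce []      = [] , deg<-[] N , ≈⇒≡-mod-xᴺ+1 ≈-refl
  reduce (a ∷ w) with v , v<N , w≡v ← reduce w
                 with v′ , v′<N , a∷v≡v′ ← reduce-top (deg<-∷ {a} v<N) =
    v′ , v′<N , mod-xᴺ+1-trans a∷w≡a∷v a∷v≡v′
    where
    a∷w≡a∷v : a ∷ w ≡ a ∷ v mod-xᴺ+1
    a∷w≡a∷v = by-multiple (∣-respʳ (≈-sym (≈-trans (∷-cong (xor-same a) (≈-refl {w ⊕ v})) (shift≈x^⊗ 1 (w ⊕ v))))
                                   (∣⇒∣⊗ (x^ 1) (multiple w≡v)))

  -- x^p w has degree below N.
  LowFrom : ℕ → Poly → Set
  LowFrom p w = ∀ i → N ≤ p + i → coeff w i ≡ false

  LowFrom-tail : ∀ {p a w} → LowFrom p (a ∷ w) → LowFrom (suc p) w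
  LowFrom-tail {p} low i N≤1+p+i = low (suc i) (subst (N ≤_) (sym (+-suc p i)) N≤1+p+i)

  head-term-vanishes : ∀ {a w} p r → p ≢ r → r < N → LowFrom p (a ∷ w) → a ∧ same-residue p r ≡ false
  head-term-vanishes {a} p r p≢r r<N low with p <? N
  ... | yes p<N = trans (cong (a ∧_) (dec-false (p ≡? r mod-N) (p≢r ∘ mod-N-below p<N r<N))) (∧-zeroʳ a)
  ... | no  p≮N = cong (_∧ same-residue p r) (low 0 (subst (N ≤_) (sym (+-identityʳ p)) (≮⇒≥ p≮N)))

  cyclicFrom-below : ∀ w p r → r < p → r < N → LowFrom p w → cyclicFrom p w r ≡ false
  cyclicFrom-below []      p r r<p r<N low = refl
  cyclicFrom-below (a ∷ w) p r r<p r<N low = cong₂ _xor_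
    (head-term-vanishes p r (≢-sym (<⇒≢ r<p)) r<N low)
    (cyclicFrom-below w (suc p) r (m<n⇒m<1+n r<p) r<N (LowFrom-tail low))

  cyclicFrom-coeff : ∀ w p r → p ≤ r → r < N → LowFrom p w → cyclicFrom p w r ≡ coeff w (r ∸ p)
  cyclicFrom-coeff []      p r p≤r r<N low = refl
  cyclicFrom-coeff (a ∷ w) p r p≤r r<N low with p ≟ r
  ... | yes refl = begin
    a ∧ same-residue p p xor cyclicFrom (suc p) w p
      ≡⟨ cong₂ _xor_ (cong (a ∧_) (dec-true (p ≡? p mod-N) mod-refl))
                     (cyclicFrom-below w (suc p) p (n<1+n p) r<N (LowFrom-tail low)) ⟩
    a ∧ true xor false                              ≡⟨ trans (xor-identityʳ (a ∧ true)) (∧-identityʳ a) ⟩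
    a                                               ≡⟨ cong (coeff (a ∷ w)) (n∸n≡0 p) ⟨
    coeff (a ∷ w) (p ∸ p)                           ∎
    where open ≡-Reasoning
  ... | no p≢r = begin
    a ∧ same-residue p r xor cyclicFrom (suc p) w r
      ≡⟨ cong (_xor cyclicFrom (suc p) w r) (head-term-vanishes p r p≢r r<N low) ⟩
    cyclicFrom (suc p) w r                          ≡⟨ cyclicFrom-coeff w (suc p) r p<r r<N (LowFrom-tail low) ⟩
    coeff (a ∷ w) (suc (r ∸ suc p))                 ≡⟨ cong (coeff (a ∷ w)) (+-∸-assoc 1 p<r) ⟨
    coeff (a ∷ w) (r ∸ p)                           ∎
    where
    open ≡-Reasoning
    p<r : p < r
    p<r = ≤∧≢⇒< p≤r p≢r

  cyclic-zero⇒multiple : ∀ w → (∀ r → cyclic w r ≡ false) → xᴺ+1 ∣ w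
  cyclic-zero⇒multiple w cyclic≡0 with v , v<N , w≡v ← reduce w =
    ∣-respʳ (⊕-cancel w v) (∣-⊕ (multiple w≡v) (∣-respʳ (≈-sym v≈0) ∣-zero))
    where
    v≈0 : v ≈ []
    v≈0 = mk≈ λ i → case i <? N of λ where
      (yes i<N) → trans (sym (cyclicFrom-coeff v 0 i z≤n i<N (vanish v<N)))
                        (trans (sym (cyclic-cong i w≡v)) (cyclic≡0 i))
      (no  i≮N) → vanish v<N i (≮⇒≥ i≮N)

  cyclic-injective : ∀ {u v} → (∀ r → cyclic u r ≡ cyclic v r) → u ≡ v mod-xᴺ+1
  cyclic-injective {u} {v} same = by-multiple (cyclic-zero⇒multiple (u ⊕ v) λ r →
    trans (cyclicFrom-⊕ 0 u v r) (trans (cong (_xor cyclic v r) (same r)) (xor-same (cyclic v r))))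

-- With 2^T ≡ 1 (mod N), every u satisfies u^(2^T) ≡ u modulo x^N + 1, so d^(2^T − 1)
-- (written d^(1 + K′) with 2^T = 2 + K′) is an idempotent generating the same ideal as d.
-- Its cyclic coefficients are invariant under r ↦ 2r, and for d ∣ x^N + 1 they determine d.
module Idempotent (h T K′ : ℕ) (2^T≡2+K′ : 2 ^ T ≡ 2 + K′) (2^T≡1 : 2 ^ T ≡ 1 mod suc (h + h)) where

  open import Data.Nat using (ℕ; zero; suc; _+_; _*_; _^_)
  open import Relation.Binary.PropositionalEquality
  open Congruence
  open import Data.Empty using (⊥-elim)
  open import Data.List using ([])
  open import Data.Nat.Properties using (*-identityˡ; *-assoc; +-identityʳ; +-suc)
  open import Data.Product using (_,_)
  open import Data.Sum using (inj₁; inj₂)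
  open Polynomial
  open Degree
  open CyclicCoefficients h

  cyclic-^2^ : ∀ j u r → cyclic (u ^ᴾ 2 ^ j) (2 ^ j * r) ≡ cyclic u r
  cyclic-^2^ zero    u r = trans (cyclicFrom-cong 0 (1 * r) (⊗-identityʳ u)) (cong (cyclic u) (*-identityˡ r))
  cyclic-^2^ (suc j) u r = begin
    cyclic (u ^ᴾ 2 ^ suc j) (2 ^ suc j * r)    ≡⟨ cong (cyclic (u ^ᴾ 2 ^ suc j)) double ⟩
    cyclic (u ^ᴾ 2 ^ suc j) (s + s)            ≡⟨ cyclicFrom-cong 0 (s + s) (^ᴾ-+ u (2 ^ j) (2 ^ j + 0)) ⟩
    cyclic (v ⊗ u ^ᴾ (2 ^ j + 0)) (s + s)      ≡⟨ cong (λ k → cyclic (v ⊗ u ^ᴾ k) (s + s)) (+-identityʳ (2 ^ j)) ⟩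
    cyclic (v ⊗ v) (s + s)                     ≡⟨ cyclic-square v s ⟩
    cyclic v s                                 ≡⟨ cyclic-^2^ j u r ⟩
    cyclic u r                                 ∎
    where
    open ≡-Reasoning
    v : Poly
    v = u ^ᴾ 2 ^ j
    s : ℕ
    s = 2 ^ j * r
    double : 2 ^ suc j * r ≡ s + s
    double = trans (*-assoc 2 (2 ^ j) r) (cong (s +_) (+-identityʳ s))

  ^2^T≡id : ∀ u → u ^ᴾ 2 ^ T ≡ u mod-xᴺ+1
  ^2^T≡id u = cyclic-injective λ r →
    trans (cyclicFrom-respʳ (u ^ᴾ 2 ^ T) 0 (mod-sym (2^T*r≡r r))) (cyclic-^2^ T u r)
    where
    2^T*r≡r : ∀ r → 2 ^ T * r ≡ r mod N
    2^T*r≡r r = mod-trans (mod-* 2^T≡1 (mod-refl {r})) (mod-reflexive (*-identityˡ r))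

  idempotent : Poly → Poly
  idempotent d = d ^ᴾ suc K′

  idempotent-idempotent : ∀ d → idempotent d ⊗ idempotent d ≡ idempotent d mod-xᴺ+1
  idempotent-idempotent d = mod-xᴺ+1-trans
    (≈⇒≡-mod-xᴺ+1 (≈-trans (≈-sym (^ᴾ-+ d (suc K′) (suc K′)))
                 (≈-trans (≈-reflexive (cong (d ^ᴾ_) (trans (+-suc (suc K′) K′) (cong (_+ K′) (sym 2^T≡2+K′)))))
                          (^ᴾ-+ d (2 ^ T) K′))))
    (mod-xᴺ+1-⊗ʳ (d ^ᴾ K′) (^2^T≡id d))

  cyclic-idempotent-double : ∀ d r → cyclic (idempotent d) (r + r) ≡ cyclic (idempotent d) r
  cyclic-idempotent-double d r =
    trans (sym (cyclic-cong (r + r) (idempotent-idempotent d))) (cyclic-square (idempotent d) r)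

  idempotent-∣ : ∀ {d d′} → d ∣ xᴺ+1 → (∀ r → cyclic (idempotent d) r ≡ cyclic (idempotent d′) r) →
                 d ∣ d′
  idempotent-∣ {d} {d′} d∣xᴺ+1 same =
    ∣-respʳ (⊕-cancel d′ (d′ ⊗ e)) (∣-⊕ (∣-trans d∣xᴺ+1 (multiple d′≡d′e)) d∣d′e)
    where
    e : Poly
    e = idempotent d
    d′≡d′e : d′ ≡ d′ ⊗ e mod-xᴺ+1
    d′≡d′e = mod-xᴺ+1-trans
      (mod-xᴺ+1-sym (subst (λ k → d′ ^ᴾ k ≡ d′ mod-xᴺ+1) 2^T≡2+K′ (^2^T≡id d′)))
      (mod-xᴺ+1-⊗ˡ d′ (cyclic-injective (λ r → sym (same r))))
    d∣d′e : d ∣ d′ ⊗ e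
    d∣d′e = ∣⇒∣⊗ d′ (d∣d⊗g d (d ^ᴾ K′))

  idempotent-injective : ∀ {d d′} → d ∣ xᴺ+1 → d′ ∣ xᴺ+1 →
                         (∀ r → cyclic (idempotent d) r ≡ cyclic (idempotent d′) r) → d ≈ d′
  idempotent-injective {d} d∣xᴺ+1 d′∣xᴺ+1 same with ≈0⊎deg≡ d
  ... | inj₁ d≈0 = ⊥-elim (deg≡⇒≉0 deg-xᴺ+1 (zero-divisor d∣xᴺ+1 d≈0))
    where
    zero-divisor : ∀ {d f} → d ∣ f → d ≈ [] → f ≈ []
    zero-divisor (divides q f≈) d≈0 = ≈-trans f≈ (⊗-zeroˡ q d≈0)
  ... | inj₂ (_ , deg-d) =
    ∣-antisym deg-d (idempotent-∣ d∣xᴺ+1 same) (idempotent-∣ d′∣xᴺ+1 (λ r → sym (same r)))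

module Factors where

  open import Data.Bool using (Bool; true; false; not; _∧_; if_then_else_)
  open import Data.Empty using (⊥-elim)
  open import Data.List using ([]; _∷_)
  open import Data.Nat using (ℕ; zero; suc; _+_; _*_; _^_; _≤_; _<_)
  open import Data.Nat.Properties
  open import Data.Nat.Tactic.RingSolver using (solve-∀)
  open import Data.Product using (∃; _,_)
  open import Data.Vec using (Vec; []; _∷_)
  open import Data.Vec.Properties using (∷-injectiveˡ; ∷-injectiveʳ)
  open import Relation.Binary.PropositionalEquality
  open import Relation.Nullary using (¬_)
  open Polynomial
  open Degree
  open PowersOfTwo using (cosetCount; ⌊7^_/2⌋; 7^≡2⌊7^/2⌋+1)

  isZero : Poly → Bool
  isZero []      = true
  isZero (a ∷ f) = not a ∧ isZero f

  isZero-sound : ∀ f → isZero f ≡ true → f ≈ []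
  isZero-sound []          _    = ≈-refl
  isZero-sound (false ∷ f) f≡0 = 0∷-zero (isZero-sound f f≡0)

  ≈-by-computation : ∀ f g → isZero (f ⊕ g) ≡ true → f ≈ g
  ≈-by-computation f g f⊕g≡0 = ⊕≈0⇒≈ (isZero-sound (f ⊕ g) f⊕g≡0)

  x+1 g gᴿ φ₇ : Poly
  x+1 = true ∷ true ∷ []
  g   = true ∷ true ∷ false ∷ true ∷ []
  gᴿ  = true ∷ false ∷ true ∷ true ∷ []
  φ₇  = true ∷ true ∷ true ∷ true ∷ true ∷ true ∷ true ∷ []

  g⊗gᴿ≈φ₇ : g ⊗ gᴿ ≈ φ₇
  g⊗gᴿ≈φ₇ = ≈-by-computation _ _ refl

  x+1⊗φ₇≈x⁷+1 : x+1 ⊗ φ₇ ≈ 𝟙 ⊕ x^ 7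
  x+1⊗φ₇≈x⁷+1 = ≈-by-computation _ _ refl

  deg-x+1 : deg x+1 ≡ 1
  deg-x+1 = deg≡-∷ deg≡-𝟙

  deg-g : deg g ≡ 3
  deg-g = deg≡-∷ (deg≡-∷ (deg≡-∷ deg≡-𝟙))

  deg-gᴿ : deg gᴿ ≡ 3
  deg-gᴿ = deg≡-∷ (deg≡-∷ (deg≡-∷ deg≡-𝟙))

  record Coprime (a b : Poly) : Set where
    constructor bezout
    field
      s t      : Poly
      identity : s ⊗ a ⊕ t ⊗ b ≈ 𝟙

  coprime-g-gᴿ : Coprime g gᴿ
  coprime-g-gᴿ = bezout (false ∷ true ∷ []) (true ∷ true ∷ []) (≈-by-computation _ _ refl)

  coprime-φ₇-x+1 : Coprime φ₇ x+1
  coprime-φ₇-x+1 = bezout 𝟙 (false ∷ true ∷ false ∷ true ∷ false ∷ true ∷ [])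
                          (≈-by-computation _ _ refl)

  coprime-sym : ∀ {a b} → Coprime a b → Coprime b a
  coprime-sym {a} {b} (bezout s t st) = bezout t s (≈-trans (⊕-comm (t ⊗ b) (s ⊗ a)) st)

  coprime-∣ʳ : ∀ {a b d} → Coprime a b → d ∣ b → Coprime a d
  coprime-∣ʳ {a} {b} {d} (bezout s t st) (divides q b≈dq) =
    bezout s (t ⊗ q) (≈-trans (⊕-cong (≈-refl {s ⊗ a}) tq⊗d≈t⊗b) st)
    where
    tq⊗d≈t⊗b : t ⊗ q ⊗ d ≈ t ⊗ b
    tq⊗d≈t⊗b = ≈-trans (⊗-assoc t q d) (⊗-congʳ t (≈-trans (⊗-comm q d) (≈-sym b≈dq)))

  coprime-∣ˡ : ∀ {a b d} → Coprime a b → d ∣ a → Coprime d b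
  coprime-∣ˡ c d∣a = coprime-sym (coprime-∣ʳ (coprime-sym c) d∣a)

  coprime-∣-⊗ : ∀ {a b c} → Coprime a b → a ∣ b ⊗ c → a ∣ c
  coprime-∣-⊗ {a} {b} {c} (bezout s t st) a∣bc =
    ∣-respʳ expand (∣-⊕ (∣⇒∣⊗ (s ⊗ c) (∣-refl {a})) (∣⇒∣⊗ t a∣bc))
    where
    open import Relation.Binary.Reasoning.Setoid ≈-setoid
    expand : s ⊗ c ⊗ a ⊕ t ⊗ (b ⊗ c) ≈ c
    expand = begin
      s ⊗ c ⊗ a ⊕ t ⊗ (b ⊗ c)     ≈⟨ ⊕-cong (≈-trans (⊗-assoc s c a)
                                                       (≈-trans (⊗-congʳ s (⊗-comm c a)) (≈-sym (⊗-assoc s a c))))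
                                             (≈-sym (⊗-assoc t b c)) ⟩
      s ⊗ a ⊗ c ⊕ t ⊗ b ⊗ c       ≈⟨ ⊗-distribʳ (s ⊗ a) (t ⊗ b) c ⟨
      (s ⊗ a ⊕ t ⊗ b) ⊗ c         ≈⟨ ⊗-congˡ c st ⟩
      𝟙 ⊗ c                       ≈⟨ ⊗-identityˡ c ⟩
      c                           ∎

  coprime-inflate : ∀ m {a b} → Coprime a b → Coprime (inflate m a) (inflate m b)
  coprime-inflate m {a} {b} (bezout s t st) = bezout (inflate m s) (inflate m t) (begin
    inflate m s ⊗ inflate m a ⊕ inflate m t ⊗ inflate m b
      ≈⟨ ⊕-cong (inflate-⊗ m s a) (inflate-⊗ m t b) ⟨
    inflate m (s ⊗ a) ⊕ inflate m (t ⊗ b)                  ≈⟨ inflate-⊕ m (s ⊗ a) (t ⊗ b) ⟨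
    inflate m (s ⊗ a ⊕ t ⊗ b)                              ≈⟨ inflate-cong m st ⟩
    inflate m 𝟙                                            ≈⟨ inflate-𝟙 m ⟩
    𝟙                                                      ∎)
    where open import Relation.Binary.Reasoning.Setoid ≈-setoid

  deg>0⇒∤𝟙 : ∀ {a n} → deg a ≡ suc n → ¬ (a ∣ 𝟙)
  deg>0⇒∤𝟙 deg-a a∣𝟙 with () ← ∣⇒deg≤ deg-a deg≡-𝟙 a∣𝟙

  coprime-𝟙 : ∀ a → Coprime a 𝟙
  coprime-𝟙 a = bezout [] 𝟙 (⊗-identityˡ 𝟙)

  coprime⇒∤ : ∀ {a b n} → deg a ≡ suc n → Coprime a b → ¬ (a ∣ b)
  coprime⇒∤ {a} {b} deg-a c a∣b =
    deg>0⇒∤𝟙 deg-a (coprime-∣-⊗ c (∣-respʳ (≈-sym (⊗-identityʳ b)) a∣b))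

  pick : Bool → Poly → Poly
  pick true  f = f
  pick false f = 𝟙

  pick-∣ : ∀ b f → pick b f ∣ f
  pick-∣ true  f = ∣-refl
  pick-∣ false f = divides f (≈-sym (⊗-identityˡ f))

  coprime-pick : ∀ {a b} c → Coprime a b → Coprime a (pick c b)
  coprime-pick true  cop = cop
  coprime-pick false cop = coprime-𝟙 _

  inflate-pick : ∀ m b f → inflate m (pick b f) ≈ pick b (inflate m f)
  inflate-pick m true  f = ≈-refl
  inflate-pick m false f = inflate-𝟙 m

  deg-pick : ∀ b {f d} → deg f ≡ d → deg (pick b f) ≡ (if b then d else 0)
  deg-pick true  deg-f = deg-f
  deg-pick false deg-f = deg≡-𝟙

  factor-selected : ∀ {p q F n} b c → deg p ≡ suc n → Coprime p F → Coprime p q →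
                    p ∣ F ⊗ (pick b p ⊗ pick c q) → b ≡ true
  factor-selected true  c _ _ _ _ = refl
  factor-selected {p} {q} {F} false c deg-p p⊥F p⊥q p∣ =
    ⊥-elim (coprime⇒∤ deg-p (coprime-pick c p⊥q)
      (∣-respʳ (⊗-identityˡ (pick c q)) (coprime-∣-⊗ p⊥F p∣)))

  bits-equal : ∀ {b c} → (b ≡ true → c ≡ true) → (c ≡ true → b ≡ true) → b ≡ c
  bits-equal {false} {false} _ _ = refl
  bits-equal {false} {true}  _ c⇒b = c⇒b refl
  bits-equal {true}  {false} b⇒c _ = sym (b⇒c refl)
  bits-equal {true}  {true}  _ _ = refl

  -- stretch e u is u(x^(7^e)).
  stretch : ℕ → Poly → Poly
  stretch e = inflate (⌊7^ e /2⌋ + ⌊7^ e /2⌋)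

  deg-stretch : ∀ e {u d} → deg u ≡ d → deg (stretch e u) ≡ 7 ^ e * d
  deg-stretch e {u} {d} deg-u =
    subst (λ m → deg (stretch e u) ≡ m * d) (sym (7^≡2⌊7^/2⌋+1 e)) (deg≡-inflate _ deg-u)

  stretch-x+1 : ∀ e → stretch e x+1 ≈ 𝟙 ⊕ x^ (7 ^ e)
  stretch-x+1 e = ≈-trans (∷-cong refl (shift-cong m (∷-cong refl (shift-zero m ≈-refl))))
                          (≈-reflexive (cong (λ k → 𝟙 ⊕ x^ k) (sym (7^≡2⌊7^/2⌋+1 e))))
    where
    m : ℕ
    m = ⌊7^ e /2⌋ + ⌊7^ e /2⌋

  stretch-x+1-suc : ∀ e → stretch (suc e) x+1 ≈ stretch e x+1 ⊗ stretch e φ₇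
  stretch-x+1-suc e = begin
    stretch (suc e) x+1               ≈⟨ stretch-x+1 (suc e) ⟩
    𝟙 ⊕ x^ (7 * 7 ^ e)                ≡⟨ cong (λ k → 𝟙 ⊕ x^ (7 * k)) (7^≡2⌊7^/2⌋+1 e) ⟩
    𝟙 ⊕ x^ (7 * suc m)                ≈⟨ ⊕-cong (≈-sym (inflate-𝟙 m)) (≈-sym (inflate-x^ m 7)) ⟩
    inflate m 𝟙 ⊕ inflate m (x^ 7)    ≈⟨ inflate-⊕ m 𝟙 (x^ 7) ⟨
    inflate m (𝟙 ⊕ x^ 7)              ≈⟨ inflate-cong m x+1⊗φ₇≈x⁷+1 ⟨
    inflate m (x+1 ⊗ φ₇)              ≈⟨ inflate-⊗ m x+1 φ₇ ⟩
    stretch e x+1 ⊗ stretch e φ₇      ∎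
    where
    open import Relation.Binary.Reasoning.Setoid ≈-setoid
    m : ℕ
    m = ⌊7^ e /2⌋ + ⌊7^ e /2⌋

  -- x^(7^e) + 1 = (x + 1) ∏_{j<e} g(x^(7^j)) gᴿ(x^(7^j)); w selects a subproduct.
  factorProduct : (e : ℕ) → Vec Bool (cosetCount e) → Poly
  factorProduct zero    (b ∷ [])      = pick b x+1
  factorProduct (suc e) (b ∷ bᴿ ∷ w) = factorProduct e w ⊗ stretch e (pick b g ⊗ pick bᴿ gᴿ)

  factorProduct-∣ : ∀ e w → factorProduct e w ∣ stretch e x+1
  factorProduct-∣ zero    (b ∷ [])      = pick-∣ b x+1
  factorProduct-∣ (suc e) (b ∷ bᴿ ∷ w) = ∣-respʳ (≈-sym (stretch-x+1-suc e))
    (∣-⊗-mono (factorProduct-∣ e w)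
              (inflate-∣ _ (∣-respʳ g⊗gᴿ≈φ₇ (∣-⊗-mono (pick-∣ b g) (pick-∣ bᴿ gᴿ)))))

  module _ (e : ℕ) where

    private
      m : ℕ
      m = ⌊7^ e /2⌋ + ⌊7^ e /2⌋

    coprime-φ₇-factorProduct : ∀ w → Coprime (stretch e φ₇) (factorProduct e w)
    coprime-φ₇-factorProduct w = coprime-∣ʳ (coprime-inflate m coprime-φ₇-x+1) (factorProduct-∣ e w)

    stretch-pick : ∀ b bᴿ → stretch e (pick b g ⊗ pick bᴿ gᴿ) ≈ pick b (stretch e g) ⊗ pick bᴿ (stretch e gᴿ)
    stretch-pick b bᴿ =
      ≈-trans (inflate-⊗ m (pick b g) (pick bᴿ gᴿ)) (⊗-cong (inflate-pick m b g) (inflate-pick m bᴿ gᴿ))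

    selects-g : ∀ w b bᴿ → stretch e g ∣ factorProduct e w ⊗ stretch e (pick b g ⊗ pick bᴿ gᴿ) → b ≡ true
    selects-g w b bᴿ g∣ = factor-selected b bᴿ (deg≡-inflate m deg-g)
      (coprime-∣ˡ (coprime-φ₇-factorProduct w) (inflate-∣ m (∣-respʳ g⊗gᴿ≈φ₇ (d∣d⊗g g gᴿ))))
      (coprime-inflate m coprime-g-gᴿ)
      (∣-respʳ (⊗-congʳ (factorProduct e w) (stretch-pick b bᴿ)) g∣)

    selects-gᴿ : ∀ w b bᴿ → stretch e gᴿ ∣ factorProduct e w ⊗ stretch e (pick b g ⊗ pick bᴿ gᴿ) → bᴿ ≡ true
    selects-gᴿ w b bᴿ gᴿ∣ = factor-selected bᴿ b (deg≡-inflate m deg-gᴿ)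
      (coprime-∣ˡ (coprime-φ₇-factorProduct w) (inflate-∣ m (∣-respʳ g⊗gᴿ≈φ₇ (d∣g⊗d gᴿ g))))
      (coprime-inflate m (coprime-sym coprime-g-gᴿ))
      (∣-respʳ (⊗-congʳ (factorProduct e w)
                        (≈-trans (stretch-pick b bᴿ) (⊗-comm (pick b (stretch e g)) (pick bᴿ (stretch e gᴿ)))))
               gᴿ∣)

    contains-g : ∀ w bᴿ → stretch e g ∣ factorProduct e w ⊗ stretch e (pick true g ⊗ pick bᴿ gᴿ)
    contains-g w bᴿ = ∣⇒∣⊗ (factorProduct e w) (inflate-∣ m (d∣d⊗g g (pick bᴿ gᴿ)))

    contains-gᴿ : ∀ w b → stretch e gᴿ ∣ factorProduct e w ⊗ stretch e (pick b g ⊗ pick true gᴿ)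
    contains-gᴿ w b = ∣⇒∣⊗ (factorProduct e w) (inflate-∣ m (d∣g⊗d gᴿ (pick b g)))

  factorProduct-injective : ∀ e {w w′} → factorProduct e w ≈ factorProduct e w′ → w ≡ w′
  factorProduct-injective zero {b ∷ []} {c ∷ []} eq =
    cong (_∷ []) (trans (sym (coeff₁ b)) (trans (at eq 1) (coeff₁ c)))
    where
    coeff₁ : ∀ b → coeff (pick b x+1) 1 ≡ b
    coeff₁ true  = refl
    coeff₁ false = refl
  factorProduct-injective (suc e) {b ∷ bᴿ ∷ w} {c ∷ cᴿ ∷ w′} eq
    with refl ← bits-equal {b} {c} (λ { refl → selects-g e w′ c cᴿ (∣-respʳ eq (contains-g e w bᴿ)) })
                                   (λ { refl → selects-g e w b bᴿ (∣-respʳ (≈-sym eq) (contains-g e w′ cᴿ)) })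
    with refl ← bits-equal {bᴿ} {cᴿ} (λ { refl → selects-gᴿ e w′ b cᴿ (∣-respʳ eq (contains-gᴿ e w b)) })
                                     (λ { refl → selects-gᴿ e w b bᴿ (∣-respʳ (≈-sym eq) (contains-gᴿ e w′ b)) }) =
    cong (λ v → b ∷ bᴿ ∷ v) (factorProduct-injective e (⊗-cancelˡ deg-level
      (≈-trans (⊗-comm level (factorProduct e w)) (≈-trans eq (⊗-comm (factorProduct e w′) level)))))
    where
    level : Poly
    level = stretch e (pick b g ⊗ pick bᴿ gᴿ)
    deg-level : deg level ≡ 7 ^ e * ((if b then 3 else 0) + (if bᴿ then 3 else 0))
    deg-level = deg-stretch e (deg≡-⊗ (deg-pick b deg-g) (deg-pick bᴿ deg-gᴿ))

  levelDegree : Bool → Bool → ℕ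
  levelDegree b bᴿ = (if b then 3 else 0) + (if bᴿ then 3 else 0)

  selectionDegree : (e : ℕ) → Vec Bool (cosetCount e) → ℕ
  selectionDegree zero    (b ∷ [])      = if b then 1 else 0
  selectionDegree (suc e) (b ∷ bᴿ ∷ w) = selectionDegree e w + 7 ^ e * levelDegree b bᴿ

  deg-factorProduct : ∀ e w → deg (factorProduct e w) ≡ selectionDegree e w
  deg-factorProduct zero    (b ∷ [])      = deg-pick b deg-x+1
  deg-factorProduct (suc e) (b ∷ bᴿ ∷ w) =
    deg≡-⊗ (deg-factorProduct e w) (deg-stretch e (deg≡-⊗ (deg-pick b deg-g) (deg-pick bᴿ deg-gᴿ)))

  selectionDegree≤7^ : ∀ e w → selectionDegree e w ≤ 7 ^ e
  selectionDegree≤7^ e w = ∣⇒deg≤ (deg-factorProduct e w)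
    (subst (deg stretch e x+1 ≡_) (*-identityʳ (7 ^ e)) (deg-stretch e deg-x+1)) (factorProduct-∣ e w)

  balanced : ∀ {e} → Vec Bool e → Vec Bool (cosetCount e)
  balanced []      = false ∷ []
  balanced (b ∷ v) = b ∷ not b ∷ balanced v

  balanced-injective : ∀ {e} {v v′ : Vec Bool e} → balanced v ≡ balanced v′ → v ≡ v′
  balanced-injective {v = []}    {[]}     _    = refl
  balanced-injective {v = b ∷ v} {b′ ∷ v′} eq =
    cong₂ _∷_ (∷-injectiveˡ eq) (balanced-injective (∷-injectiveʳ (∷-injectiveʳ eq)))

  -- A selection of degree ⌊7^e/2⌋ = (7^e − 1)/2 omits x + 1 and takes exactly one of
  -- g, gᴿ at every level, since the levels below j contribute at most 7^j.
  half-degree⇒balanced : ∀ e w → selectionDegree e w ≡ ⌊7^ e /2⌋ →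
                         ∃ λ (v : Vec Bool e) → w ≡ balanced v
  half-degree⇒balanced zero    (false ∷ []) _ = [] , refl
  half-degree⇒balanced (suc e) (b ∷ bᴿ ∷ w) total =
    level b bᴿ (trans (cong (λ n → D + n * levelDegree b bᴿ) (sym (7^≡2⌊7^/2⌋+1 e))) total)
    where
    H D : ℕ
    H = ⌊7^ e /2⌋
    D = selectionDegree e w
    D≤2H+1 : D ≤ suc (H + H)
    D≤2H+1 = subst (D ≤_) (7^≡2⌊7^/2⌋+1 e) (selectionDegree≤7^ e w)
    middle : D + suc (H + H) * 3 ≡ 7 * H + 3 → D ≡ H
    middle D≡ = +-cancelʳ-≡ (suc (H + H) * 3) D H (trans D≡ (regroup H))
      where
      regroup : ∀ H → 7 * H + 3 ≡ H + suc (H + H) * 3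
      regroup = solve-∀
    level : ∀ b bᴿ → D + suc (H + H) * levelDegree b bᴿ ≡ 7 * H + 3 →
            ∃ λ (v : Vec Bool (suc e)) → b ∷ bᴿ ∷ w ≡ balanced v
    level false false D≡ =
      ⊥-elim (<⇒≱ (too-big H) (subst (_≤ suc (H + H)) (trans (sym (D+N*0 D)) D≡) D≤2H+1))
      where
      too-big : ∀ H → suc (H + H) < 7 * H + 3
      too-big H = subst (suc (suc (H + H)) ≤_) (sym (regroup H)) (m≤m+n _ _)
        where
        regroup : ∀ H → 7 * H + 3 ≡ suc (suc (H + H)) + (5 * H + 1)
        regroup = solve-∀
      D+N*0 : ∀ D → D + suc (H + H) * 0 ≡ D
      D+N*0 D = trans (cong (D +_) (*-zeroʳ (suc (H + H)))) (+-identityʳ D)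
    level true  true  D≡ = ⊥-elim (<⇒≱ (too-small H) (subst (suc (H + H) * 6 ≤_) D≡ (m≤n+m _ D)))
      where
      too-small : ∀ H → 7 * H + 3 < suc (H + H) * 6
      too-small H = subst (suc (7 * H + 3) ≤_) (sym (regroup H)) (m≤m+n _ _)
        where
        regroup : ∀ H → suc (H + H) * 6 ≡ suc (7 * H + 3) + (5 * H + 2)
        regroup = solve-∀
    level true  false D≡ with v , w≡ ← half-degree⇒balanced e w (middle D≡) =
      true ∷ v , cong (λ u → true ∷ false ∷ u) w≡
    level false true  D≡ with v , w≡ ← half-degree⇒balanced e w (middle D≡) =
      false ∷ v , cong (λ u → false ∷ true ∷ u) w≡

module Divisors (e : ℕ) where

  open import Data.Nat using (ℕ; zero; suc; _+_; _*_; _^_; _∸_; _<_)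
  open import Data.Bool using (Bool)
  open import Data.Fin using (Fin; zero; suc; combine; remQuot)
  open import Data.Fin.Properties using (2↔Bool; remQuot-combine; combine-remQuot; pigeonhole)
  import Data.Fin as Fin
  import Data.Fin.Properties as Finₚ
  open import Data.Empty using (⊥-elim)
  open import Data.Nat.Properties
  open import Data.Product using (∃; ∃₂; _×_; _,_; proj₁; proj₂)
  open import Data.Vec using (Vec; []; _∷_; lookup; map)
  open import Data.Vec.Properties using (lookup-map)
  open import Function.Bundles using (Inverse)
  open import Relation.Binary.PropositionalEquality
  open Congruence
  open Polynomial
  open PowersOfTwo
  open Factors
  open CyclicCoefficients ⌊7^ e /2⌋

  private
    T K′ : ℕ
    T  = 3 * 7 ^ e
    K′ = 2 ^ T ∸ 2

    2^T≡2+K′ : 2 ^ T ≡ 2 + K′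
    2^T≡2+K′ = sym (m+[n∸m]≡n (^-monoʳ-≤ 2 (≤-trans (m^n>0 7 e) (m≤n*m (7 ^ e) 3))))

    2^T≡1 : 2 ^ T ≡ 1 mod N
    2^T≡1 = subst (2 ^ T ≡ 1 mod_) (7^≡2⌊7^/2⌋+1 e) (2^[3·7^e]≡1 e)

  open Idempotent ⌊7^ e /2⌋ T K′ 2^T≡2+K′ 2^T≡1

  xᴺ+1≈stretch : xᴺ+1 ≈ stretch e x+1
  xᴺ+1≈stretch = ≈-trans (⊕-comm (x^ N) 𝟙)
    (≈-trans (≈-reflexive (cong (λ k → 𝟙 ⊕ x^ k) (sym (7^≡2⌊7^/2⌋+1 e)))) (≈-sym (stretch-x+1 e)))

  signature : Poly → Vec Bool (cosetCount e)
  signature d = map (cyclic (idempotent d)) (cosetReps e)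

  cyclic-idempotent-2^ : ∀ d k ρ → cyclic (idempotent d) (2 ^ k * ρ) ≡ cyclic (idempotent d) ρ
  cyclic-idempotent-2^ d zero    ρ = cong (cyclic (idempotent d)) (+-identityʳ ρ)
  cyclic-idempotent-2^ d (suc k) ρ = trans (cong (cyclic (idempotent d)) (double (2 ^ k) ρ))
    (trans (cyclic-idempotent-double d (2 ^ k * ρ)) (cyclic-idempotent-2^ d k ρ))
    where
    double : ∀ a ρ → 2 * a * ρ ≡ a * ρ + a * ρ
    double a ρ = trans (*-assoc 2 a ρ) (cong (a * ρ +_) (+-identityʳ (a * ρ)))

  cosetIndex : ℕ → Fin (cosetCount e)
  cosetIndex r = proj₁ (proj₂ (coset-decomposition e r))

  cyclic-via-signature : ∀ d r → cyclic (idempotent d) r ≡ lookup (signature d) (cosetIndex r)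
  cyclic-via-signature d r with k , c , 2^kρ≡r ← coset-decomposition e r = begin
    cyclic (idempotent d) r            ≡⟨ cyclicFrom-respʳ (idempotent d) 0 (mod-sym 2^kρ≡r′) ⟩
    cyclic (idempotent d) (2 ^ k * ρ)  ≡⟨ cyclic-idempotent-2^ d k ρ ⟩
    cyclic (idempotent d) ρ            ≡⟨ lookup-map c (cyclic (idempotent d)) (cosetReps e) ⟨
    lookup (signature d) c             ∎
    where
    open ≡-Reasoning
    ρ : ℕ
    ρ = lookup (cosetReps e) c
    2^kρ≡r′ : 2 ^ k * ρ ≡ r mod N
    2^kρ≡r′ = subst (2 ^ k * ρ ≡ r mod_) (7^≡2⌊7^/2⌋+1 e) 2^kρ≡r

  signature-injective : ∀ {d d′} → d ∣ xᴺ+1 → d′ ∣ xᴺ+1 → signature d ≡ signature d′ → d ≈ d′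
  signature-injective {d} {d′} d∣ d′∣ same = idempotent-injective d∣ d′∣ λ r →
    trans (cyclic-via-signature d r)
          (trans (cong (λ s → lookup s (cosetIndex r)) same) (sym (cyclic-via-signature d′ r)))

  toFin : ∀ {k} → Vec Bool k → Fin (2 ^ k)
  toFin []      = zero
  toFin (b ∷ v) = combine (Inverse.from 2↔Bool b) (toFin v)

  fromFin : ∀ k → Fin (2 ^ k) → Vec Bool k
  fromFin zero    _ = []
  fromFin (suc k) i = Inverse.to 2↔Bool (proj₁ (remQuot {2} (2 ^ k) i))
                    ∷ fromFin k (proj₂ (remQuot {2} (2 ^ k) i))

  fromFin-toFin : ∀ {k} (v : Vec Bool k) → fromFin k (toFin v) ≡ v
  fromFin-toFin []               = refl
  fromFin-toFin {suc k} (b ∷ v) = trans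
    (cong (λ p → Inverse.to 2↔Bool (proj₁ p) ∷ fromFin k (proj₂ p))
          (remQuot-combine {2} {2 ^ k} (Inverse.from 2↔Bool b) (toFin v)))
    (cong₂ _∷_ (Inverse.strictlyInverseˡ 2↔Bool b) (fromFin-toFin v))

  toFin-fromFin : ∀ k (i : Fin (2 ^ k)) → toFin (fromFin k i) ≡ i
  toFin-fromFin zero    zero = refl
  toFin-fromFin (suc k) i = trans
    (cong₂ combine (Inverse.strictlyInverseʳ 2↔Bool (proj₁ (remQuot {2} (2 ^ k) i)))
                   (toFin-fromFin k (proj₂ (remQuot {2} (2 ^ k) i))))
    (combine-remQuot {2} (2 ^ k) i)

  toFin-injective : ∀ {k} {v w : Vec Bool k} → toFin v ≡ toFin w → v ≡ w
  toFin-injective {v = v} {w} eq = trans (sym (fromFin-toFin v)) (trans (cong (fromFin _) eq) (fromFin-toFin w))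

  fromFin-injective : ∀ k {i j : Fin (2 ^ k)} → fromFin k i ≡ fromFin k j → i ≡ j
  fromFin-injective k {i} {j} eq = trans (sym (toFin-fromFin k i)) (trans (cong toFin eq) (toFin-fromFin k j))

  factorProduct-∣xᴺ+1 : ∀ w → factorProduct e w ∣ xᴺ+1
  factorProduct-∣xᴺ+1 w = ∣-respʳ (≈-sym xᴺ+1≈stretch) (factorProduct-∣ e w)

  -- The 2^(2e+1) factor products are distinct divisors and the signature embeds the
  -- divisors into Vec Bool (2e+1), so by counting every divisor is a factor product.
  divisor⇒factorProduct : ∀ {d} → d ∣ xᴺ+1 → ∃ λ w → d ≈ factorProduct e w
  divisor⇒factorProduct {d} d∣ = collision (pigeonhole (n<1+n (2 ^ L)) code)
    where
    L : ℕ
    L = cosetCount e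
    code : Fin (suc (2 ^ L)) → Fin (2 ^ L)
    code zero    = toFin (signature d)
    code (suc i) = toFin (signature (factorProduct e (fromFin L i)))
    collision : (∃₂ λ i j → i Fin.< j × code i ≡ code j) → ∃ λ w → d ≈ factorProduct e w
    collision (zero  , suc j , _   , same) =
      fromFin L j , signature-injective d∣ (factorProduct-∣xᴺ+1 (fromFin L j)) (toFin-injective same)
    collision (suc i , suc j , i<j , same) = ⊥-elim (Finₚ.<-irrefl (cong suc i≡j) i<j)
      where
      i≡j : i ≡ j
      i≡j = fromFin-injective L (factorProduct-injective e (signature-injective
              (factorProduct-∣xᴺ+1 (fromFin L i)) (factorProduct-∣xᴺ+1 (fromFin L j)) (toFin-injective same)))

module Reciprocal where

  open import Data.Bool using (Bool; true; false; _xor_; _∧_)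
  open import Data.Bool.Properties using (xor-identityʳ; ∧-zeroʳ; ∧-identityʳ)
  open import Data.List using ([]; _∷_)
  open import Data.Nat using (ℕ; zero; suc; pred; _+_; _*_; _∸_; _<_; s≤s)
  open import Data.Nat.Properties
  open import Relation.Binary.PropositionalEquality
  open import Data.Empty using (⊥-elim)
  open import Data.Product using (_,_)
  open import Function using (_∘_)
  open import Relation.Nullary using (yes; no)
  open Polynomial
  open Degree

  -- reciprocal L f = x^(L−1) f(1/x) for deg f < L.
  reciprocal : ℕ → Poly → Poly
  reciprocal L []      = []
  reciprocal L (a ∷ f) = reciprocal (pred L) f ⊕ scale a (x^ pred L)

  reciprocal-zero : ∀ L {f} → f ≈ [] → reciprocal L f ≈ []
  reciprocal-zero L {[]}    f≈0 = ≈-refl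
  reciprocal-zero L {a ∷ f} f≈0 with ∷-zero⁻ f≈0
  ... | refl , f≈0′ = ≈-trans (⊕-identityʳ _) (reciprocal-zero (pred L) f≈0′)

  reciprocal-⊕ : ∀ L f g → reciprocal L (f ⊕ g) ≈ reciprocal L f ⊕ reciprocal L g
  reciprocal-⊕ L []      g       = ≈-refl
  reciprocal-⊕ L (a ∷ f) []      = ≈-sym (⊕-identityʳ _)
  reciprocal-⊕ L (a ∷ f) (b ∷ g) =
    ≈-trans (⊕-cong (reciprocal-⊕ (pred L) f g) (scale-xor a b (x^ pred L)))
            (⊕-interchange (reciprocal (pred L) f) (reciprocal (pred L) g)
                           (scale a (x^ pred L)) (scale b (x^ pred L)))

  reciprocal-cong : ∀ L {f g} → f ≈ g → reciprocal L f ≈ reciprocal L g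
  reciprocal-cong L {f} {g} f≈g =
    ⊕≈0⇒≈ (≈-trans (≈-sym (reciprocal-⊕ L f g)) (reciprocal-zero L (≈⇒⊕≈0 f≈g)))

  reciprocal-scale : ∀ L a f → reciprocal L (scale a f) ≈ scale a (reciprocal L f)
  reciprocal-scale L false f = ≈-refl
  reciprocal-scale L true  f = ≈-refl

  reciprocal-shiftˡ : ∀ k L f → reciprocal (k + L) (shift k f) ≈ reciprocal L f
  reciprocal-shiftˡ zero    L f = ≈-refl
  reciprocal-shiftˡ (suc k) L f = ≈-trans (⊕-identityʳ _) (reciprocal-shiftˡ k L f)

  reciprocal-+ : ∀ L j {f} → deg f < L → reciprocal (L + j) f ≈ shift j (reciprocal L f)
  reciprocal-+ zero    j {f}     f<0 =
    ≈-trans (reciprocal-zero j (deg<-zero f<0)) (≈-sym (shift-zero j (reciprocal-zero 0 (deg<-zero f<0))))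
  reciprocal-+ (suc L) j {[]}    _ = ≈-sym (shift-zero j ≈-refl)
  reciprocal-+ (suc L) j {a ∷ f} f<L = begin
    reciprocal (L + j) f ⊕ scale a (x^ (L + j))              ≈⟨ ⊕-cong (reciprocal-+ L j (deg<-tail f<L)) (scale-cong a x^L+j) ⟩
    shift j (reciprocal L f) ⊕ scale a (shift j (x^ L))      ≈⟨ ⊕-cong (≈-refl {shift j (reciprocal L f)}) (scale-shift a) ⟩
    shift j (reciprocal L f) ⊕ shift j (scale a (x^ L))      ≈⟨ shift-⊕ j (reciprocal L f) (scale a (x^ L)) ⟩
    shift j (reciprocal L f ⊕ scale a (x^ L))                ∎
    where
    open import Relation.Binary.Reasoning.Setoid ≈-setoid
    x^L+j : x^ (L + j) ≈ shift j (x^ L)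
    x^L+j = ≈-reflexive (trans (cong (λ k → shift k 𝟙) (+-comm L j)) (sym (shift-+ j L 𝟙)))
    scale-shift : ∀ a → scale a (shift j (x^ L)) ≈ shift j (scale a (x^ L))
    scale-shift false = ≈-sym (shift-zero j ≈-refl)
    scale-shift true  = ≈-refl

  reciprocal-⊗ : ∀ p q {f g} → deg f < suc p → deg g < suc q →
                 reciprocal (suc (p + q)) (f ⊗ g) ≈ reciprocal (suc p) f ⊗ reciprocal (suc q) g
  reciprocal-⊗ p q {[]}    {g} f<p g<q = ≈-refl
  reciprocal-⊗ p q {a ∷ f} {g} f<p g<q = begin
    reciprocal (suc (p + q)) (scale a g ⊕ (false ∷ f ⊗ g))
      ≈⟨ reciprocal-⊕ (suc (p + q)) (scale a g) (false ∷ f ⊗ g) ⟩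
    reciprocal (suc (p + q)) (scale a g) ⊕ (reciprocal (p + q) (f ⊗ g) ⊕ [])
      ≈⟨ ⊕-cong leading-part (≈-trans (⊕-identityʳ _) (tail-part p f<p)) ⟩
    scale a (x^ p) ⊗ R ⊕ reciprocal p f ⊗ R
      ≈⟨ ⊕-comm (scale a (x^ p) ⊗ R) (reciprocal p f ⊗ R) ⟩
    reciprocal p f ⊗ R ⊕ scale a (x^ p) ⊗ R
      ≈⟨ ⊗-distribʳ (reciprocal p f) (scale a (x^ p)) R ⟨
    (reciprocal p f ⊕ scale a (x^ p)) ⊗ R ∎
    where
    open import Relation.Binary.Reasoning.Setoid ≈-setoid
    R : Poly
    R = reciprocal (suc q) g
    leading-part : reciprocal (suc (p + q)) (scale a g) ≈ scale a (x^ p) ⊗ R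
    leading-part = begin
      reciprocal (suc (p + q)) (scale a g)  ≈⟨ reciprocal-scale (suc (p + q)) a g ⟩
      scale a (reciprocal (suc (p + q)) g)  ≡⟨ cong (λ k → scale a (reciprocal (suc k) g)) (+-comm p q) ⟩
      scale a (reciprocal (suc q + p) g)    ≈⟨ scale-cong a (reciprocal-+ (suc q) p g<q) ⟩
      scale a (shift p R)                   ≈⟨ scale-cong a (shift≈x^⊗ p R) ⟩
      scale a (x^ p ⊗ R)                    ≈⟨ scale-⊗ a (x^ p) R ⟨
      scale a (x^ p) ⊗ R                    ∎
    tail-part : ∀ p → deg (a ∷ f) < suc p → reciprocal (p + q) (f ⊗ g) ≈ reciprocal p f ⊗ R
    tail-part zero    f<1 = ≈-trans (reciprocal-zero q (⊗-zeroˡ g (deg<-zero (deg<-tail f<1))))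
                                    (≈-sym (⊗-zeroˡ R (reciprocal-zero 0 (deg<-zero (deg<-tail f<1)))))
    tail-part (suc p) f<p = reciprocal-⊗ p q (deg<-tail f<p) g<q

  reciprocal-inflate : ∀ m d {u} → deg u < suc d →
                       reciprocal (suc (d * suc m)) (inflate m u) ≈ inflate m (reciprocal (suc d) u)
  reciprocal-inflate m d       {[]}    _ = ≈-refl
  reciprocal-inflate m zero    {a ∷ u} u<1 = begin
    reciprocal 0 (shift m (inflate m u)) ⊕ scale a 𝟙
      ≈⟨ ⊕-cong (reciprocal-zero 0 (shift-zero m (inflate-zero m u≈0))) (≈-refl {scale a 𝟙}) ⟩
    scale a 𝟙
      ≈⟨ ⊕-cong (≈-sym (inflate-zero m (reciprocal-zero 0 u≈0)))
                (≈-trans (scale-cong a (≈-sym (inflate-𝟙 m))) (≈-sym (inflate-scale m a 𝟙))) ⟩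
    inflate m (reciprocal 0 u) ⊕ inflate m (scale a 𝟙)
      ≈⟨ inflate-⊕ m (reciprocal 0 u) (scale a 𝟙) ⟨
    inflate m (reciprocal 0 u ⊕ scale a 𝟙) ∎
    where
    open import Relation.Binary.Reasoning.Setoid ≈-setoid
    u≈0 : u ≈ []
    u≈0 = deg<-zero (deg<-tail u<1)
  reciprocal-inflate m (suc d) {a ∷ u} u<d = begin
    reciprocal (suc (m + d * suc m)) (shift m (inflate m u)) ⊕ scale a (x^ (suc d * suc m))
      ≡⟨ cong (λ k → reciprocal k (shift m (inflate m u)) ⊕ scale a (x^ (suc d * suc m)))
              (sym (+-suc m (d * suc m))) ⟩
    reciprocal (m + suc (d * suc m)) (shift m (inflate m u)) ⊕ scale a (x^ (suc d * suc m))
      ≈⟨ ⊕-cong (reciprocal-shiftˡ m (suc (d * suc m)) (inflate m u)) (scale-cong a (≈-sym (inflate-x^ m (suc d)))) ⟩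
    reciprocal (suc (d * suc m)) (inflate m u) ⊕ scale a (inflate m (x^ suc d))
      ≈⟨ ⊕-cong (reciprocal-inflate m d (deg<-tail u<d)) (≈-sym (inflate-scale m a (x^ suc d))) ⟩
    inflate m (reciprocal (suc d) u) ⊕ inflate m (scale a (x^ suc d))
      ≈⟨ inflate-⊕ m (reciprocal (suc d) u) (scale a (x^ suc d)) ⟨
    inflate m (reciprocal (suc d) u ⊕ scale a (x^ suc d)) ∎
    where open import Relation.Binary.Reasoning.Setoid ≈-setoid

  deg<-reciprocal : ∀ L {f} → deg f < L → deg (reciprocal L f) < L
  deg<-reciprocal L       {[]}    _ = deg<-[] L
  deg<-reciprocal zero    {a ∷ f} f<0 =
    deg<-cong (≈-sym (reciprocal-zero 0 (deg<-zero f<0))) (deg<-[] 0)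
  deg<-reciprocal (suc L) {a ∷ f} f<L =
    deg<-⊕ (deg<-mono (n≤1+n L) (deg<-reciprocal L (deg<-tail f<L))) (deg<-scale a (beyond (deg≡-x^ L)))

  coeff-x^-≢ : ∀ k i → i ≢ k → coeff (x^ k) i ≡ false
  coeff-x^-≢ zero    zero    i≢k = ⊥-elim (i≢k refl)
  coeff-x^-≢ zero    (suc i) _   = refl
  coeff-x^-≢ (suc k) zero    _   = refl
  coeff-x^-≢ (suc k) (suc i) i≢k = coeff-x^-≢ k i (i≢k ∘ cong suc)

  coeff-reciprocal : ∀ L {f} i → deg f < L → i < L → coeff (reciprocal L f) i ≡ coeff f (L ∸ suc i)
  coeff-reciprocal L       {[]}    i _ _ = refl
  coeff-reciprocal (suc L) {a ∷ f} i f<L (s≤s i≤L) with i ≟ L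
  ... | yes refl = begin
    coeff (reciprocal L f ⊕ scale a (x^ L)) L           ≡⟨ coeff-⊕ (reciprocal L f) (scale a (x^ L)) L ⟩
    coeff (reciprocal L f) L xor coeff (scale a (x^ L)) L
      ≡⟨ cong₂ _xor_ (vanish (deg<-reciprocal L (deg<-tail f<L)) L ≤-refl)
                     (trans (coeff-scale a (x^ L) L) (cong (a ∧_) (leading (deg≡-x^ L)))) ⟩
    a ∧ true                                            ≡⟨ ∧-identityʳ a ⟩
    a                                                   ≡⟨ cong (coeff (a ∷ f)) (n∸n≡0 L) ⟨
    coeff (a ∷ f) (L ∸ L)                               ∎
    where open ≡-Reasoning
  ... | no i≢L = begin
    coeff (reciprocal L f ⊕ scale a (x^ L)) i           ≡⟨ coeff-⊕ (reciprocal L f) (scale a (x^ L)) i ⟩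
    coeff (reciprocal L f) i xor coeff (scale a (x^ L)) i
      ≡⟨ cong₂ _xor_ (coeff-reciprocal L i (deg<-tail f<L) i<L)
                     (trans (coeff-scale a (x^ L) i) (trans (cong (a ∧_) (coeff-x^-≢ L i i≢L)) (∧-zeroʳ a))) ⟩
    coeff f (L ∸ suc i) xor false                       ≡⟨ xor-identityʳ _ ⟩
    coeff (a ∷ f) (suc (L ∸ suc i))                     ≡⟨ cong (coeff (a ∷ f)) (+-∸-assoc 1 i<L) ⟨
    coeff (a ∷ f) (L ∸ i)                               ∎
    where
    open ≡-Reasoning
    i<L : i < L
    i<L = ≤∧≢⇒< i≤L i≢L

  reciprocal-involutive : ∀ L {f} → deg f < L → reciprocal L (reciprocal L f) ≈ f
  reciprocal-involutive L {f} f<L = mk≈ coefficients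
    where
    L∸1+i<L : ∀ {i L} → i < L → L ∸ suc i < L
    L∸1+i<L {i} {suc L} _ = s≤s (m∸n≤m L i)
    L∸[L∸1+i] : ∀ {i L} → i < L → L ∸ suc (L ∸ suc i) ≡ i
    L∸[L∸1+i] {i} {suc L} (s≤s i≤L) = m∸[m∸n]≡n i≤L
    coefficients : ∀ i → coeff (reciprocal L (reciprocal L f)) i ≡ coeff f i
    coefficients i with i <? L
    ... | yes i<L = trans (coeff-reciprocal L i (deg<-reciprocal L f<L) i<L)
                      (trans (coeff-reciprocal L (L ∸ suc i) f<L (L∸1+i<L i<L)) (cong (coeff f) (L∸[L∸1+i] i<L)))
    ... | no  i≮L =
      trans (vanish (deg<-reciprocal L (deg<-reciprocal L f<L)) i (≮⇒≥ i≮L)) (sym (vanish f<L i (≮⇒≥ i≮L)))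

module Correlation where

  open import Data.Bool using (Bool; true; false; _xor_; _∧_)
  open import Data.Bool.Properties using (xor-assoc; ∧-comm; ∧-zeroʳ)
  open import Data.List using ([]; _∷_; replicate)
  open import Data.Nat using (ℕ; zero; suc; _+_; _*_; _∸_; _≤_; _<_; z≤n; s≤s; s≤s⁻¹)
  open import Data.Nat.Properties
  open import Function using (_∘_)
  open import Relation.Binary.PropositionalEquality
  open import Relation.Nullary using (yes; no)
  open Polynomial
  open Degree
  open Reciprocal

  xorSum : (ℕ → Bool) → ℕ → Bool
  xorSum t zero    = false
  xorSum t (suc m) = t 0 xor xorSum (t ∘ suc) m

  xorSum-cong : ∀ {t u} m → (∀ j → j < m → t j ≡ u j) → xorSum t m ≡ xorSum u m
  xorSum-cong zero    t≡u = refl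
  xorSum-cong (suc m) t≡u = cong₂ _xor_ (t≡u 0 (s≤s z≤n)) (xorSum-cong m (λ j j<m → t≡u (suc j) (s≤s j<m)))

  xorSum-zero : ∀ {t} m → (∀ j → j < m → t j ≡ false) → xorSum t m ≡ false
  xorSum-zero zero    t≡0 = refl
  xorSum-zero (suc m) t≡0 = cong₂ _xor_ (t≡0 0 (s≤s z≤n)) (xorSum-zero m (λ j j<m → t≡0 (suc j) (s≤s j<m)))

  xorSum-truncate : ∀ {t} m n → m ≤ n → (∀ j → m ≤ j → j < n → t j ≡ false) → xorSum t n ≡ xorSum t m
  xorSum-truncate zero    n       _         t≡0 = xorSum-zero n (λ j → t≡0 j z≤n)
  xorSum-truncate {t} (suc m) (suc n) (s≤s m≤n) t≡0 =
    cong (t 0 xor_) (xorSum-truncate m n m≤n (λ j m≤j j<n → t≡0 (suc j) (s≤s m≤j) (s≤s j<n)))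

  xorSum-+ : ∀ t a b → xorSum t (a + b) ≡ xorSum t a xor xorSum (λ j → t (a + j)) b
  xorSum-+ t zero    b = refl
  xorSum-+ t (suc a) b = trans (cong (t 0 xor_) (xorSum-+ (t ∘ suc) a b)) (sym (xor-assoc (t 0) _ _))

  coeff-⊗ : ∀ f g i → coeff (f ⊗ g) i ≡ xorSum (λ j → coeff f j ∧ coeff g (i ∸ j)) (suc i)
  coeff-⊗ []      g i       = sym (xorSum-zero (suc i) (λ _ _ → refl))
  coeff-⊗ (a ∷ f) g zero    = trans (coeff-⊕ (scale a g) (false ∷ f ⊗ g) 0) (cong (_xor false) (coeff-scale a g 0))
  coeff-⊗ (a ∷ f) g (suc i) =
    trans (coeff-⊕ (scale a g) (false ∷ f ⊗ g) (suc i)) (cong₂ _xor_ (coeff-scale a g (suc i)) (coeff-⊗ f g i))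

  ones : ℕ → Poly
  ones k = replicate k true

  coeff-ones-< : ∀ k i → i < k → coeff (ones k) i ≡ true
  coeff-ones-< (suc k) zero    _         = refl
  coeff-ones-< (suc k) (suc i) (s≤s i<k) = coeff-ones-< k i i<k

  deg≡-ones : ∀ k → deg ones (suc k) ≡ k
  deg≡-ones zero    = deg≡-𝟙
  deg≡-ones (suc k) = deg≡-∷ (deg≡-ones k)

  deg<-ones : ∀ k → deg ones k < k
  deg<-ones zero    = deg<-[] 0
  deg<-ones (suc k) = deg<-∷ (deg<-ones k)

  ones-+ : ∀ a b → ones (a + b) ≈ ones a ⊕ shift a (ones b)
  ones-+ zero    b = ≈-refl
  ones-+ (suc a) b = ∷-cong refl (ones-+ a b)

  ones-* : ∀ m k → ones (k * suc m) ≈ ones (suc m) ⊗ inflate m (ones k)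
  ones-* m zero    = ≈-sym (⊗-zeroʳ (ones (suc m)))
  ones-* m (suc k) = begin
    ones (suc m + k * suc m)
      ≈⟨ ones-+ (suc m) (k * suc m) ⟩
    ones (suc m) ⊕ shift (suc m) (ones (k * suc m))
      ≈⟨ ⊕-cong (≈-sym (⊗-identityʳ (ones (suc m)))) (shift-cong (suc m) (ones-* m k)) ⟩
    ones (suc m) ⊗ 𝟙 ⊕ shift (suc m) (ones (suc m) ⊗ inflate m (ones k))
      ≈⟨ ⊕-cong (≈-refl {ones (suc m) ⊗ 𝟙}) (≈-sym (⊗-shift (ones (suc m)) (suc m) (inflate m (ones k)))) ⟩
    ones (suc m) ⊗ 𝟙 ⊕ ones (suc m) ⊗ shift (suc m) (inflate m (ones k))
      ≈⟨ ⊗-distribˡ (ones (suc m)) 𝟙 (shift (suc m) (inflate m (ones k))) ⟨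
    ones (suc m) ⊗ inflate m (ones (suc k)) ∎
    where open import Relation.Binary.Reasoning.Setoid ≈-setoid

  -- For f = a₀ + ⋯ + a_h x^h, the coefficient of x^(h ± k) in f · x^h f(1/x) is
  -- Σ_j a_j a_(j+k), so all these sums are odd iff the product is 1 + x + ⋯ + x^(2h).
  module Autocorrelation (h : ℕ) {f : Poly} (f<h+1 : deg f < suc h) where

    autocorrelation : ℕ → Bool
    autocorrelation k = xorSum (λ j → coeff f j ∧ coeff f (j + k)) (suc h ∸ k)

    F : Poly
    F = f ⊗ reciprocal (suc h) f

    deg<-F : deg F < suc (h + h)
    deg<-F = deg<-⊗ f<h+1 (deg<-reciprocal (suc h) f<h+1)

    coeff-F-upper : ∀ k → coeff F (h + k) ≡ autocorrelation k
    coeff-F-upper k = begin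
      coeff F (h + k)                              ≡⟨ coeff-⊗ f (reciprocal (suc h) f) (h + k) ⟩
      xorSum t (suc (h + k))                       ≡⟨ cong (xorSum t) (trans (cong suc (+-comm h k)) (sym (+-suc k h))) ⟩
      xorSum t (k + suc h)                         ≡⟨ xorSum-+ t k (suc h) ⟩
      xorSum t k xor xorSum (λ j → t (k + j)) (suc h)
                                                   ≡⟨ cong (_xor xorSum (λ j → t (k + j)) (suc h)) (xorSum-zero k below) ⟩
      xorSum (λ j → t (k + j)) (suc h)             ≡⟨ xorSum-cong (suc h) middle ⟩
      xorSum u (suc h)                             ≡⟨ xorSum-truncate (suc h ∸ k) (suc h) (m∸n≤m (suc h) k) above ⟩
      xorSum u (suc h ∸ k)                         ≡⟨ xorSum-cong (suc h ∸ k) (λ j _ → swap j) ⟩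
      autocorrelation k                            ∎
      where
      open ≡-Reasoning
      t u : ℕ → Bool
      t j = coeff f j ∧ coeff (reciprocal (suc h) f) (h + k ∸ j)
      u j = coeff f (k + j) ∧ coeff f j
      below : ∀ j → j < k → t j ≡ false
      below j j<k = trans (cong (coeff f j ∧_) (vanish (deg<-reciprocal (suc h) f<h+1) (h + k ∸ j) h<h+k∸j))
                          (∧-zeroʳ (coeff f j))
        where
        h<h+k∸j : suc h ≤ h + k ∸ j
        h<h+k∸j = subst (_≤ h + k ∸ j) (trans (cong (_∸ j) (+-suc h j)) (m+n∸n≡m (suc h) j))
                        (∸-monoˡ-≤ j (+-monoʳ-≤ h j<k))
      middle : ∀ j → j < suc h → t (k + j) ≡ u j
      middle j (s≤s j≤h) = cong (coeff f (k + j) ∧_) (begin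
        coeff (reciprocal (suc h) f) (h + k ∸ (k + j))
          ≡⟨ cong (coeff (reciprocal (suc h) f)) (trans (cong (_∸ (k + j)) (+-comm h k)) ([m+n]∸[m+o]≡n∸o k h j)) ⟩
        coeff (reciprocal (suc h) f) (h ∸ j)            ≡⟨ coeff-reciprocal (suc h) (h ∸ j) f<h+1 (s≤s (m∸n≤m h j)) ⟩
        coeff f (h ∸ (h ∸ j))                           ≡⟨ cong (coeff f) (m∸[m∸n]≡n j≤h) ⟩
        coeff f j                                       ∎)
      above : ∀ j → suc h ∸ k ≤ j → j < suc h → u j ≡ false
      above j h+1∸k≤j _ = cong (_∧ coeff f j)
        (vanish f<h+1 (k + j) (≤-trans (m≤n+m∸n (suc h) k) (+-monoʳ-≤ k h+1∸k≤j)))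
      swap : ∀ j → u j ≡ coeff f j ∧ coeff f (j + k)
      swap j = trans (∧-comm (coeff f (k + j)) (coeff f j)) (cong (λ i → coeff f j ∧ coeff f i) (+-comm k j))

    F-palindromic : reciprocal (suc (h + h)) F ≈ F
    F-palindromic = ≈-trans (reciprocal-⊗ h h f<h+1 (deg<-reciprocal (suc h) f<h+1))
      (≈-trans (⊗-congʳ (reciprocal (suc h) f) (reciprocal-involutive (suc h) f<h+1)) (⊗-comm (reciprocal (suc h) f) f))

    coeff-F-lower : ∀ k → k ≤ h → coeff F (h ∸ k) ≡ autocorrelation k
    coeff-F-lower k k≤h = begin
      coeff F (h ∸ k)                                        ≡⟨ at F-palindromic (h ∸ k) ⟨
      coeff (reciprocal (suc (h + h)) F) (h ∸ k)
        ≡⟨ coeff-reciprocal (suc (h + h)) (h ∸ k) deg<-F (s≤s (≤-trans (m∸n≤m h k) (m≤m+n h h))) ⟩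
      coeff F (h + h ∸ (h ∸ k))
        ≡⟨ cong (coeff F) (trans (+-∸-assoc h (m∸n≤m h k)) (cong (h +_) (m∸[m∸n]≡n k≤h))) ⟩
      coeff F (h + k)                                        ≡⟨ coeff-F-upper k ⟩
      autocorrelation k                                      ∎
      where open ≡-Reasoning

    all-true⇒F≈ones : (∀ k → k < suc h → autocorrelation k ≡ true) → F ≈ ones (suc (h + h))
    all-true⇒F≈ones all-true = mk≈ coefficients
      where
      coefficients : ∀ i → coeff F i ≡ coeff (ones (suc (h + h))) i
      coefficients i with i <? suc (h + h) | h ≤? i
      ... | no  i≮ | _ = trans (vanish deg<-F i (≮⇒≥ i≮)) (sym (vanish (deg<-ones (suc (h + h))) i (≮⇒≥ i≮)))
      ... | yes i< | yes h≤i = begin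
        coeff F i               ≡⟨ cong (coeff F) (m+[n∸m]≡n h≤i) ⟨
        coeff F (h + (i ∸ h))   ≡⟨ coeff-F-upper (i ∸ h) ⟩
        autocorrelation (i ∸ h) ≡⟨ all-true (i ∸ h) (s≤s (subst (i ∸ h ≤_) (m+n∸n≡m h h) (∸-monoˡ-≤ h (s≤s⁻¹ i<)))) ⟩
        true                    ≡⟨ coeff-ones-< (suc (h + h)) i i< ⟨
        coeff (ones (suc (h + h))) i ∎
        where open ≡-Reasoning
      ... | yes i< | no h≰i = begin
        coeff F i               ≡⟨ cong (coeff F) (m∸[m∸n]≡n i≤h) ⟨
        coeff F (h ∸ (h ∸ i))   ≡⟨ coeff-F-lower (h ∸ i) (m∸n≤m h i) ⟩
        autocorrelation (h ∸ i) ≡⟨ all-true (h ∸ i) (s≤s (m∸n≤m h i)) ⟩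
        true                    ≡⟨ coeff-ones-< (suc (h + h)) i i< ⟨
        coeff (ones (suc (h + h))) i ∎
        where
        open ≡-Reasoning
        i≤h : i ≤ h
        i≤h = <⇒≤ (≰⇒> h≰i)

    F≈ones⇒all-true : F ≈ ones (suc (h + h)) → ∀ k → k < suc h → autocorrelation k ≡ true
    F≈ones⇒all-true F≈ones k (s≤s k≤h) = trans (sym (coeff-F-upper k))
      (trans (at F≈ones (h + k)) (coeff-ones-< (suc (h + h)) (h + k) (s≤s (+-monoʳ-≤ h k≤h))))

module Sequences where

  open import Data.Bool using (Bool; true; false; not; _xor_; _∧_)
  open import Data.Bool.Properties using (not-involutive; not-distribˡ-xor; xor-same; xor-identityʳ)
  open import Data.List using (List; []; _∷_; map; _++_; applyUpTo; length)
  open import Data.List.Properties using (length-map; length-++)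
  open import Data.List.Membership.Propositional using (_∈_)
  open import Data.List.Membership.Propositional.Properties using (∈-map⁺; ∈-map⁻; ∈-++⁺ˡ; ∈-++⁺ʳ; ∈-++⁻)
  open import Data.List.Relation.Unary.Any using (here)
  open import Data.List.Relation.Unary.Unique.Propositional using (Unique)
  open import Data.List.Relation.Unary.Unique.Propositional.Properties using (map⁺; ++⁺)
  import Data.List.Relation.Unary.AllPairs as AllPairs
  import Data.List.Relation.Unary.All as ListAll
  open import Data.Nat using (ℕ; zero; suc; _+_; _*_; _^_; _∸_; _<_)
  open import Data.Nat.Properties using (+-identityʳ)
  open import Data.Nat.ListAction using (sum)
  open import Data.Product using (_×_; _,_)
  open import Data.Sum using (_⊎_; inj₁; inj₂)
  open import Data.Vec using (Vec; []; _∷_)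
  open import Data.Vec.Properties using (∷-injectiveʳ)
  open import Data.Vec.Relation.Unary.All using (All; []; _∷_)
  open import Relation.Binary.PropositionalEquality
  open import Relation.Nullary using (¬_)
  open import Defs
  open Polynomial
  open Degree
  open Correlation
  open Reciprocal

  isOdd : ℕ → Bool
  isOdd zero    = false
  isOdd (suc n) = not (isOdd n)

  isOdd-+ : ∀ m n → isOdd (m + n) ≡ isOdd m xor isOdd n
  isOdd-+ zero    n = refl
  isOdd-+ (suc m) n = trans (cong not (isOdd-+ m n)) (not-distribˡ-xor (isOdd m) (isOdd n))

  isOdd-* : ∀ m n → isOdd (m * n) ≡ isOdd m ∧ isOdd n
  isOdd-* zero    n = refl
  isOdd-* (suc m) n = trans (isOdd-+ n (m * n)) (trans (cong (isOdd n xor_) (isOdd-* m n)) (lemma (isOdd m) (isOdd n)))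
    where
    lemma : ∀ x y → y xor (x ∧ y) ≡ not x ∧ y
    lemma true  y = xor-same y
    lemma false y = xor-identityʳ y

  Odd⇒isOdd : ∀ {m} → Odd m → isOdd m ≡ true
  Odd⇒isOdd odd-one    = refl
  Odd⇒isOdd (odd-ss o) = trans (not-involutive _) (Odd⇒isOdd o)

  isOdd⇒Odd : ∀ m → isOdd m ≡ true → Odd m
  isOdd⇒Odd (suc zero)    _ = odd-one
  isOdd⇒Odd (suc (suc m)) p = odd-ss (isOdd⇒Odd m (trans (sym (not-involutive _)) p))

  toPoly : ∀ {n} → Seq n → Poly
  toPoly []      = []
  toPoly (x ∷ a) = isOdd x ∷ toPoly a

  coeff-toPoly : ∀ {n} (a : Seq n) j → coeff (toPoly a) j ≡ isOdd (entry a j)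
  coeff-toPoly []      j       = refl
  coeff-toPoly (x ∷ a) zero    = refl
  coeff-toPoly (x ∷ a) (suc j) = coeff-toPoly a j

  deg<-toPoly : ∀ {n} (a : Seq n) → deg toPoly a < n
  deg<-toPoly []      = deg<-[] 0
  deg<-toPoly (x ∷ a) = deg<-∷ (deg<-toPoly a)

  isOdd-sum : ∀ (g : ℕ → ℕ) t m → isOdd (sum (map g (applyUpTo t m))) ≡ xorSum (λ j → isOdd (g (t j))) m
  isOdd-sum g t zero    = refl
  isOdd-sum g t (suc m) = trans (isOdd-+ (g (t 0)) _) (cong (isOdd (g (t 0)) xor_) (isOdd-sum g (λ j → t (suc j)) m))

  isOdd-A : ∀ {n} (a : Seq n) k →
            isOdd (A a k) ≡ xorSum (λ j → coeff (toPoly a) j ∧ coeff (toPoly a) (j + k)) (n ∸ k)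
  isOdd-A {n} a k = trans (isOdd-sum (λ j → entry a j * entry a (j + k)) (λ j → j) (n ∸ k))
    (xorSum-cong (n ∸ k) (λ j _ → trans (isOdd-* (entry a j) (entry a (j + k)))
                                        (sym (cong₂ _∧_ (coeff-toPoly a j) (coeff-toPoly a (j + k))))))

  module _ (h : ℕ) (a : Seq (suc h)) where
    open Autocorrelation h (deg<-toPoly a)

    VeryOdd⇒product≈ones : VeryOdd a → toPoly a ⊗ reciprocal (suc h) (toPoly a) ≈ ones (suc (h + h))
    VeryOdd⇒product≈ones very-odd =
      all-true⇒F≈ones λ k k<n → trans (sym (isOdd-A a k)) (Odd⇒isOdd (very-odd k k<n))

    product≈ones⇒VeryOdd : toPoly a ⊗ reciprocal (suc h) (toPoly a) ≈ ones (suc (h + h)) → VeryOdd a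
    product≈ones⇒VeryOdd F≈ones k k<n =
      isOdd⇒Odd (A a k) (trans (isOdd-A a k) (F≈ones⇒all-true F≈ones k k<n))

  Binary : ∀ {n} → Seq n → Set
  Binary = All (λ x → x ≡ 0 ⊎ x ≡ 1)

  fromBool : Bool → ℕ
  fromBool false = 0
  fromBool true  = 1

  fromPoly : ∀ n → Poly → Seq n
  fromPoly zero    g       = []
  fromPoly (suc n) []      = 0 ∷ fromPoly n []
  fromPoly (suc n) (b ∷ g) = fromBool b ∷ fromPoly n g

  fromPoly-binary : ∀ n g → Binary (fromPoly n g)
  fromPoly-binary zero    g           = []
  fromPoly-binary (suc n) []          = inj₁ refl ∷ fromPoly-binary n []
  fromPoly-binary (suc n) (false ∷ g) = inj₁ refl ∷ fromPoly-binary n g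
  fromPoly-binary (suc n) (true  ∷ g) = inj₂ refl ∷ fromPoly-binary n g

  fromPoly-cong : ∀ n {g g′} → g ≈ g′ → fromPoly n g ≡ fromPoly n g′
  fromPoly-cong zero    _ = refl
  fromPoly-cong (suc n) {[]}    {[]}     _ = refl
  fromPoly-cong (suc n) {[]}    {b ∷ g′} g≈g′ with refl , g′≈0 ← ∷-zero⁻ (≈-sym g≈g′) =
    cong (0 ∷_) (fromPoly-cong n (≈-sym g′≈0))
  fromPoly-cong (suc n) {b ∷ g} {[]}     g≈g′ with refl , g≈0 ← ∷-zero⁻ g≈g′ = cong (0 ∷_) (fromPoly-cong n g≈0)
  fromPoly-cong (suc n) {b ∷ g} {b′ ∷ g′} g≈g′ with refl , g≈g′ ← ∷-injective g≈g′ =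
    cong (fromBool b ∷_) (fromPoly-cong n g≈g′)

  fromPoly-toPoly : ∀ {n} {a : Seq n} → Binary a → fromPoly n (toPoly a) ≡ a
  fromPoly-toPoly []               = refl
  fromPoly-toPoly (inj₁ refl ∷ bs) = cong (0 ∷_) (fromPoly-toPoly bs)
  fromPoly-toPoly (inj₂ refl ∷ bs) = cong (1 ∷_) (fromPoly-toPoly bs)

  toPoly-fromPoly : ∀ n {g} → deg g < n → toPoly (fromPoly n g) ≈ g
  toPoly-fromPoly zero    g<0 = ≈-sym (deg<-zero g<0)
  toPoly-fromPoly (suc n) {[]}        _   = 0∷-zero (toPoly-fromPoly n (deg<-[] n))
  toPoly-fromPoly (suc n) {false ∷ g} g<n = ∷-cong refl (toPoly-fromPoly n (deg<-tail g<n))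
  toPoly-fromPoly (suc n) {true  ∷ g} g<n = ∷-cong refl (toPoly-fromPoly n (deg<-tail g<n))

  binary⇒∈allSeqs : ∀ {n} {a : Seq n} → Binary a → a ∈ allSeqs n
  binary⇒∈allSeqs []                          = here refl
  binary⇒∈allSeqs {suc n} (inj₁ refl ∷ bs) = ∈-++⁺ˡ (∈-map⁺ (0 ∷_) (binary⇒∈allSeqs bs))
  binary⇒∈allSeqs {suc n} (inj₂ refl ∷ bs) = ∈-++⁺ʳ (map (0 ∷_) (allSeqs n)) (∈-map⁺ (1 ∷_) (binary⇒∈allSeqs bs))

  ∈allSeqs⇒binary : ∀ {n} {a : Seq n} → a ∈ allSeqs n → Binary a
  ∈allSeqs⇒binary {zero}  {[]} _ = []
  ∈allSeqs⇒binary {suc n} a∈ with ∈-++⁻ (map (0 ∷_) (allSeqs n)) a∈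
  ... | inj₁ a∈₀ with _ , b∈ , refl ← ∈-map⁻ (0 ∷_) a∈₀ = inj₁ refl ∷ ∈allSeqs⇒binary b∈
  ... | inj₂ a∈₁ with _ , b∈ , refl ← ∈-map⁻ (1 ∷_) a∈₁ = inj₂ refl ∷ ∈allSeqs⇒binary b∈

  allSeqs-unique : ∀ n → Unique (allSeqs n)
  allSeqs-unique zero    = ListAll.[] AllPairs.∷ AllPairs.[]
  allSeqs-unique (suc n) =
    ++⁺ (map⁺ ∷-injectiveʳ (allSeqs-unique n)) (map⁺ ∷-injectiveʳ (allSeqs-unique n)) disjoint
    where
    disjoint : ∀ {a} → ¬ (a ∈ map (0 ∷_) (allSeqs n) × a ∈ map (1 ∷_) (allSeqs n))
    disjoint (a∈₀ , a∈₁) with _ , _ , refl ← ∈-map⁻ (0 ∷_) a∈₀ with _ , _ , () ← ∈-map⁻ (1 ∷_) a∈₁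

  allBoolVecs : (k : ℕ) → List (Vec Bool k)
  allBoolVecs zero    = [] ∷ []
  allBoolVecs (suc k) = map (true ∷_) (allBoolVecs k) ++ map (false ∷_) (allBoolVecs k)

  ∈-allBoolVecs : ∀ {k} (v : Vec Bool k) → v ∈ allBoolVecs k
  ∈-allBoolVecs []               = here refl
  ∈-allBoolVecs {suc k} (true  ∷ v) = ∈-++⁺ˡ (∈-map⁺ (true ∷_) (∈-allBoolVecs v))
  ∈-allBoolVecs {suc k} (false ∷ v) = ∈-++⁺ʳ (map (true ∷_) (allBoolVecs k)) (∈-map⁺ (false ∷_) (∈-allBoolVecs v))

  allBoolVecs-unique : ∀ k → Unique (allBoolVecs k)
  allBoolVecs-unique zero    = ListAll.[] AllPairs.∷ AllPairs.[]
  allBoolVecs-unique (suc k) =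
    ++⁺ (map⁺ ∷-injectiveʳ (allBoolVecs-unique k)) (map⁺ ∷-injectiveʳ (allBoolVecs-unique k)) disjoint
    where
    disjoint : ∀ {v} → ¬ (v ∈ map (true ∷_) (allBoolVecs k) × v ∈ map (false ∷_) (allBoolVecs k))
    disjoint (v∈₁ , v∈₀) with _ , _ , refl ← ∈-map⁻ (true ∷_) v∈₁ with _ , _ , () ← ∈-map⁻ (false ∷_) v∈₀

  length-allBoolVecs : ∀ k → length (allBoolVecs k) ≡ 2 ^ k
  length-allBoolVecs zero    = refl
  length-allBoolVecs (suc k) = begin
    length (map (true ∷_) (allBoolVecs k) ++ map (false ∷_) (allBoolVecs k))
      ≡⟨ length-++ (map (true ∷_) (allBoolVecs k)) ⟩
    length (map (true ∷_) (allBoolVecs k)) + length (map (false ∷_) (allBoolVecs k))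
      ≡⟨ cong₂ _+_ (length-map (true ∷_) (allBoolVecs k)) (length-map (false ∷_) (allBoolVecs k)) ⟩
    length (allBoolVecs k) + length (allBoolVecs k)
      ≡⟨ cong₂ _+_ (length-allBoolVecs k) (trans (length-allBoolVecs k) (sym (+-identityʳ (2 ^ k)))) ⟩
    2 ^ suc k ∎
    where open ≡-Reasoning

module BalancedProducts where

  open import Data.Bool using (Bool; true; false; not)
  open import Data.Nat using (ℕ; zero; suc; _+_; _*_; _^_; _<_)
  open import Data.Nat.Properties
  open import Data.Nat.Tactic.RingSolver using (solve-∀)
  open import Data.Vec using (Vec; []; _∷_; map)
  open import Relation.Binary.PropositionalEquality
  open Polynomial
  open Degree
  open PowersOfTwo using (⌊7^_/2⌋; 7^≡2⌊7^/2⌋+1)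
  open Factors
  open Reciprocal
  open Correlation
  open Sequences

  ones-7^ : ∀ e → ones (7 ^ suc e) ≈ ones (7 ^ e) ⊗ stretch e φ₇
  ones-7^ e = ≈-trans (≈-reflexive (cong ones (cong (7 *_) (7^≡2⌊7^/2⌋+1 e))))
    (≈-trans (ones-* m 7) (≈-reflexive (cong (λ k → ones k ⊗ stretch e φ₇) (sym (7^≡2⌊7^/2⌋+1 e)))))
    where
    m : ℕ
    m = ⌊7^ e /2⌋ + ⌊7^ e /2⌋

  x+1⊗ones : ∀ e → x+1 ⊗ ones (7 ^ e) ≈ stretch e x+1
  x+1⊗ones zero    = ≈-by-computation _ _ refl
  x+1⊗ones (suc e) = begin
    x+1 ⊗ ones (7 ^ suc e)                    ≈⟨ ⊗-congʳ x+1 (ones-7^ e) ⟩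
    x+1 ⊗ (ones (7 ^ e) ⊗ stretch e φ₇)       ≈⟨ ⊗-assoc x+1 (ones (7 ^ e)) (stretch e φ₇) ⟨
    x+1 ⊗ ones (7 ^ e) ⊗ stretch e φ₇         ≈⟨ ⊗-congˡ (stretch e φ₇) (x+1⊗ones e) ⟩
    stretch e x+1 ⊗ stretch e φ₇              ≈⟨ stretch-x+1-suc e ⟨
    stretch (suc e) x+1                       ∎
    where open import Relation.Binary.Reasoning.Setoid ≈-setoid

  balancedProduct : (e : ℕ) → Vec Bool e → Poly
  balancedProduct e v = factorProduct e (balanced v)

  levelDegree-balanced : ∀ b → levelDegree b (not b) ≡ 3
  levelDegree-balanced true  = refl
  levelDegree-balanced false = refl

  selectionDegree-balanced : ∀ e (v : Vec Bool e) → selectionDegree e (balanced v) ≡ ⌊7^ e /2⌋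
  selectionDegree-balanced zero    []      = refl
  selectionDegree-balanced (suc e) (b ∷ v) = begin
    selectionDegree e (balanced v) + 7 ^ e * levelDegree b (not b)
      ≡⟨ cong₂ (λ d k → d + k * levelDegree b (not b)) (selectionDegree-balanced e v) (7^≡2⌊7^/2⌋+1 e) ⟩
    ⌊7^ e /2⌋ + suc (⌊7^ e /2⌋ + ⌊7^ e /2⌋) * levelDegree b (not b)
      ≡⟨ cong (λ k → ⌊7^ e /2⌋ + suc (⌊7^ e /2⌋ + ⌊7^ e /2⌋) * k) (levelDegree-balanced b) ⟩
    ⌊7^ e /2⌋ + suc (⌊7^ e /2⌋ + ⌊7^ e /2⌋) * 3
      ≡⟨ regroup ⌊7^ e /2⌋ ⟩
    ⌊7^ suc e /2⌋ ∎
    where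
    open ≡-Reasoning
    regroup : ∀ H → H + suc (H + H) * 3 ≡ 7 * H + 3
    regroup = solve-∀

  deg-balancedProduct : ∀ e v → deg (balancedProduct e v) ≡ ⌊7^ e /2⌋
  deg-balancedProduct e v =
    subst (deg balancedProduct e v ≡_) (selectionDegree-balanced e v) (deg-factorProduct e (balanced v))

  balancedProduct-complement : ∀ e v → balancedProduct e v ⊗ balancedProduct e (map not v) ≈ ones (7 ^ e)
  balancedProduct-complement zero    []      = ≈-by-computation _ _ refl
  balancedProduct-complement (suc e) (b ∷ v) = begin
    (P ⊗ stretch e c) ⊗ (P̃ ⊗ stretch e c̃)      ≈⟨ ⊗-interchange P (stretch e c) P̃ (stretch e c̃) ⟩
    (P ⊗ P̃) ⊗ (stretch e c ⊗ stretch e c̃)     ≈⟨ ⊗-cong (balancedProduct-complement e v) (≈-sym (inflate-⊗ _ c c̃)) ⟩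
    ones (7 ^ e) ⊗ stretch e (c ⊗ c̃)          ≈⟨ ⊗-congʳ (ones (7 ^ e)) (inflate-cong _ (level-complement b)) ⟩
    ones (7 ^ e) ⊗ stretch e φ₇               ≈⟨ ones-7^ e ⟨
    ones (7 ^ suc e)                          ∎
    where
    open import Relation.Binary.Reasoning.Setoid ≈-setoid
    P P̃ c c̃ : Poly
    P = balancedProduct e v
    P̃ = balancedProduct e (map not v)
    c = pick b g ⊗ pick (not b) gᴿ
    c̃ = pick (not b) g ⊗ pick (not (not b)) gᴿ
    level-complement : ∀ b → (pick b g ⊗ pick (not b) gᴿ) ⊗ (pick (not b) g ⊗ pick (not (not b)) gᴿ) ≈ φ₇
    level-complement true  = ≈-by-computation _ _ refl
    level-complement false = ≈-by-computation _ _ refl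

  reciprocal-balancedProduct : ∀ e v →
    reciprocal (suc ⌊7^ e /2⌋) (balancedProduct e v) ≈ balancedProduct e (map not v)
  reciprocal-balancedProduct zero    []      = ≈-refl
  reciprocal-balancedProduct (suc e) (b ∷ v) = begin
    reciprocal (suc ⌊7^ suc e /2⌋) (P ⊗ stretch e c)
      ≡⟨ cong (λ k → reciprocal (suc k) (P ⊗ stretch e c)) (regroup H) ⟩
    reciprocal (suc (H + 3 * suc m)) (P ⊗ stretch e c)
      ≈⟨ reciprocal-⊗ H (3 * suc m) (beyond (deg-balancedProduct e v)) deg<-level ⟩
    reciprocal (suc H) P ⊗ reciprocal (suc (3 * suc m)) (inflate m c)
      ≈⟨ ⊗-cong (reciprocal-balancedProduct e v) (reciprocal-inflate m 3 (beyond deg-c)) ⟩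
    P̃ ⊗ inflate m (reciprocal 4 c)
      ≈⟨ ⊗-congʳ P̃ (inflate-cong m (reciprocal-level b)) ⟩
    P̃ ⊗ stretch e c̃ ∎
    where
    open import Relation.Binary.Reasoning.Setoid ≈-setoid
    H m : ℕ
    H = ⌊7^ e /2⌋
    m = H + H
    P P̃ c c̃ : Poly
    P = balancedProduct e v
    P̃ = balancedProduct e (map not v)
    c = pick b g ⊗ pick (not b) gᴿ
    c̃ = pick (not b) g ⊗ pick (not (not b)) gᴿ
    regroup : ∀ H → 7 * H + 3 ≡ H + 3 * suc (H + H)
    regroup = solve-∀
    deg-c : deg c ≡ 3
    deg-c = subst (deg c ≡_) (levelDegree-balanced b) (deg≡-⊗ (deg-pick b deg-g) (deg-pick (not b) deg-gᴿ))
    deg<-level : deg inflate m c < suc (3 * suc m)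
    deg<-level = subst (λ k → deg inflate m c < suc k) (*-comm (suc m) 3) (beyond (deg≡-inflate m deg-c))
    reciprocal-level : ∀ b → reciprocal 4 (pick b g ⊗ pick (not b) gᴿ) ≈ pick (not b) g ⊗ pick (not (not b)) gᴿ
    reciprocal-level true  = ≈-by-computation _ _ refl
    reciprocal-level false = ≈-by-computation _ _ refl

module VeryOddSequences (e : ℕ) where

  open import Data.Bool using (Bool; not)
  open import Data.List using (length; filter)
  import Data.List as List
  open import Data.List.Membership.Propositional using (_∈_)
  open import Data.List.Membership.Propositional.Properties using (∈-map⁺; ∈-map⁻; ∈-filter⁺; ∈-filter⁻)
  open import Data.List.Membership.Propositional.Properties.WithK using (unique∧set⇒bag)
  open import Data.List.Properties using (length-map)
  open import Data.List.Relation.Binary.BagAndSetEquality using (∼bag⇒↭)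
  open import Data.List.Relation.Binary.Permutation.Propositional.Properties using (↭-length)
  open import Data.List.Relation.Unary.Unique.Propositional.Properties using (map⁺; filter⁺)
  open import Data.Nat using (ℕ; suc; _+_; _^_)
  open import Data.Product using (∃; _,_; proj₁; proj₂)
  open import Data.Vec using (Vec; map)
  open import Function.Bundles using (mk⇔)
  open import Relation.Binary.PropositionalEquality
  open import Defs
  open Polynomial
  open Degree
  open PowersOfTwo using (cosetCount; ⌊7^_/2⌋; 7^≡2⌊7^/2⌋+1)
  open Factors
  open Reciprocal
  open Correlation
  open Sequences
  open BalancedProducts

  open CyclicCoefficients ⌊7^ e /2⌋ using (xᴺ+1)
  open Divisors e using (xᴺ+1≈stretch; divisor⇒factorProduct)

  h n : ℕ
  h = ⌊7^ e /2⌋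
  n = suc h

  veryOddSequence : Vec Bool e → Seq n
  veryOddSequence v = fromPoly n (balancedProduct e v)

  toPoly-veryOddSequence : ∀ v → toPoly (veryOddSequence v) ≈ balancedProduct e v
  toPoly-veryOddSequence v = toPoly-fromPoly n (beyond (deg-balancedProduct e v))

  veryOddSequence-injective : ∀ {v v′} → veryOddSequence v ≡ veryOddSequence v′ → v ≡ v′
  veryOddSequence-injective {v} {v′} eq = balanced-injective (factorProduct-injective e
    (≈-trans (≈-sym (toPoly-veryOddSequence v))
             (≈-trans (≈-reflexive (cong toPoly eq)) (toPoly-veryOddSequence v′))))

  veryOddSequence-veryOdd : ∀ v → VeryOdd (veryOddSequence v)
  veryOddSequence-veryOdd v = product≈ones⇒VeryOdd h (veryOddSequence v) (begin
    f ⊗ reciprocal n f                                       ≈⟨ ⊗-cong f≈ (reciprocal-cong n f≈) ⟩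
    balancedProduct e v ⊗ reciprocal n (balancedProduct e v)
      ≈⟨ ⊗-congʳ (balancedProduct e v) (reciprocal-balancedProduct e v) ⟩
    balancedProduct e v ⊗ balancedProduct e (map not v)      ≈⟨ balancedProduct-complement e v ⟩
    ones (7 ^ e)                                             ≡⟨ cong ones (7^≡2⌊7^/2⌋+1 e) ⟩
    ones (suc (h + h))                                       ∎)
    where
    open import Relation.Binary.Reasoning.Setoid ≈-setoid
    f : Poly
    f = toPoly (veryOddSequence v)
    f≈ : f ≈ balancedProduct e v
    f≈ = toPoly-veryOddSequence v

  ones-∣-xᴺ+1 : ones (suc (h + h)) ∣ xᴺ+1
  ones-∣-xᴺ+1 = subst (λ k → ones k ∣ xᴺ+1) (7^≡2⌊7^/2⌋+1 e)
    (∣-respʳ (≈-trans (x+1⊗ones e) (≈-sym xᴺ+1≈stretch)) (d∣g⊗d (ones (7 ^ e)) x+1))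

  veryOdd⇒veryOddSequence : ∀ {a} → a ∈ allSeqs n → VeryOdd a → ∃ λ v → a ≡ veryOddSequence v
  veryOdd⇒veryOddSequence {a} a∈ very-odd = v , (begin
    a                                ≡⟨ fromPoly-toPoly (∈allSeqs⇒binary a∈) ⟨
    fromPoly n f                     ≡⟨ fromPoly-cong n f≈ ⟩
    fromPoly n (factorProduct e w)   ≡⟨ cong (λ u → fromPoly n (factorProduct e u)) w≡ ⟩
    veryOddSequence v                ∎)
    where
    open ≡-Reasoning
    f : Poly
    f = toPoly a
    product≈ : f ⊗ reciprocal n f ≈ ones (suc (h + h))
    product≈ = VeryOdd⇒product≈ones h a very-odd
    f∣ : f ∣ xᴺ+1
    f∣ = ∣-trans (∣-respʳ product≈ (d∣d⊗g f (reciprocal n f))) ones-∣-xᴺ+1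
    w : Vec Bool (cosetCount e)
    w = proj₁ (divisor⇒factorProduct f∣)
    f≈ : f ≈ factorProduct e w
    f≈ = proj₂ (divisor⇒factorProduct f∣)
    deg-f : deg f ≡ h
    deg-f = deg≡-maximal-factor (deg<-toPoly a) (deg<-reciprocal n (deg<-toPoly a))
                                (deg≡-cong (≈-sym product≈) (deg≡-ones (h + h)))
    deg-w : selectionDegree e w ≡ h
    deg-w = deg≡-unique (deg-factorProduct e w) (deg≡-cong f≈ deg-f)
    v : Vec Bool e
    v = proj₁ (half-degree⇒balanced e w deg-w)
    w≡ : w ≡ balanced v
    w≡ = proj₂ (half-degree⇒balanced e w deg-w)

  veryOdd⇒listed : ∀ {a} → a ∈ filter veryOdd? (allSeqs n) → a ∈ List.map veryOddSequence (allBoolVecs e)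
  veryOdd⇒listed {a} a∈ with a∈all , very-odd ← ∈-filter⁻ veryOdd? a∈
                        with v , refl ← veryOdd⇒veryOddSequence a∈all very-odd =
    ∈-map⁺ veryOddSequence (∈-allBoolVecs v)

  listed⇒veryOdd : ∀ {a} → a ∈ List.map veryOddSequence (allBoolVecs e) → a ∈ filter veryOdd? (allSeqs n)
  listed⇒veryOdd a∈ with v , _ , refl ← ∈-map⁻ veryOddSequence a∈ =
    ∈-filter⁺ veryOdd? (binary⇒∈allSeqs (fromPoly-binary n (balancedProduct e v))) (veryOddSequence-veryOdd v)

  S≡2^e : S n ≡ 2 ^ e
  S≡2^e = begin
    length (filter veryOdd? (allSeqs n))               ≡⟨ ↭-length (∼bag⇒↭ (unique∧set⇒bag
                                                            (filter⁺ veryOdd? (allSeqs-unique n))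
                                                            (map⁺ veryOddSequence-injective (allBoolVecs-unique e))
                                                            (mk⇔ veryOdd⇒listed listed⇒veryOdd))) ⟩
    length (List.map veryOddSequence (allBoolVecs e))  ≡⟨ length-map veryOddSequence (allBoolVecs e) ⟩
    length (allBoolVecs e)                             ≡⟨ length-allBoolVecs e ⟩
    2 ^ e                                              ∎
    where open ≡-Reasoning

open PowersOfTwo using (⌊7^_/2⌋)

proposition3 : (e : ℕ) → e ≥ 1 → ∃ λ (n : ℕ) → S n ≡ 2 ^ e
proposition3 e _ = suc ⌊7^ e /2⌋ , VeryOddSequences.S≡2^e e
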